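{- Let $p$ be a prime with $p\equiv 1 \pmod 8$, write $p-1=2^e m$ with $m$ odd, and let $a\in\mathbb{F}_p$ be a nonzero quadratic residue. Let $E$ be the singular cubic $y^2=x(x+a)^2$ over $\mathbb{F}_p$ and $E(\mathbb{F}_p)$ its group of nonsingular $\mathbb{F}_p$-points together with $\infty$. Let $t\in\mathbb{F}_p$, $t\neq0$, be such that $t^2+a$ is a quadratic non-residue modulo $p$, and let $P=(t^2,\,t(t^2+a))\in E(\mathbb{F}_p)$. Then there exists an integer $i$ with $0\le i\le e-1$ such that $2^i mP$ is a point of order $4$ in $E(\mathbb{F}_p)$; consequently, writing $2^imP=(z,w)$, one has $z=a$ and $w/(2a)$ is a square root of $a$ modulo $p$.
   Context: The point $(-a,0)$ is the unique singular point of $E$. $E(\mathbb{F}_p)$ denotes the set of all $(x,y)\in\mathbb{F}_p^2$ with $y^2=x(x+a)^2$ and $(x,y)\neq(-a,0)$, together with a point at infinity $\infty$, with the chord-and-tangent group law: $\infty$ is the identity, $-(x,y)=(x,-y)$; for $x_1\neq x_2$, $(x_1,y_1)+(x_2,y_2)=(x_3,y_3)$ with $k=(y_2-y_1)/(x_2-x_1)$, $x_3=k^2-2a-x_1-x_2$, $y_3=k(x_1-x_3)-y_1$; points with equal $x$ and opposite $y$ sum to $\infty$; for $y_1\neq0$, $2(x_1,y_1)=(x_3,y_3)$ with $k=(x_1+a)(3x_1+a)/(2y_1)$, $x_3=k^2-2a-2x_1$, $y_3=k(x_1-x_3)-y_1$. -}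

module Defs where

open import Data.Nat using (ℕ; zero; suc; _+_; _*_; _∸_; _^_; NonZero; _≟_)
open import Data.Nat.DivMod using (_%_)
open import Data.Product using (_×_; _,_; ∃-syntax)
open import Data.Maybe using (Maybe; just; nothing)
open import Relation.Nullary using (yes; no)
open import Relation.Binary.PropositionalEquality using (_≡_)

-- Arithmetic in F_p, elements represented by their canonical
-- representatives in {0, …, p-1}.
module Fp (p : ℕ) .{{_ : NonZero p}} where

  _+ₚ_ : ℕ → ℕ → ℕ
  x +ₚ y = (x + y) % p

  -ₚ_ : ℕ → ℕ
  -ₚ x = (p ∸ (x % p)) % p

  _-ₚ_ : ℕ → ℕ → ℕ
  x -ₚ y = x +ₚ (-ₚ y)

  _*ₚ_ : ℕ → ℕ → ℕ
  x *ₚ y = (x * y) % p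

  -- inverse via Fermat's little theorem (p prime): x⁻¹ = x^(p-2)
  invₚ : ℕ → ℕ
  invₚ x = (x ^ (p ∸ 2)) % p

  _/ₚ_ : ℕ → ℕ → ℕ
  x /ₚ y = x *ₚ invₚ y

  -- b is a square in F_p (0 counts as a square)
  IsSquare : ℕ → Set
  IsSquare b = ∃[ c ] (c * c) % p ≡ b % p

  -- Points of E(F_p): nothing = ∞, just (x , y) an affine point.
  Point : Set
  Point = Maybe (ℕ × ℕ)

  -- chord-and-tangent law on y² = x(x+a)², i.e. y² = x³ + 2a x² + a² x
  add : ℕ → Point → Point → Point
  add a nothing Q = Q
  add a P nothing = P
  add a (just (x₁ , y₁)) (just (x₂ , y₂)) with (x₁ % p) ≟ (x₂ % p)
  ... | no _ =
        let k  = (y₂ -ₚ y₁) /ₚ (x₂ -ₚ x₁)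
            x₃ = (((k *ₚ k) -ₚ (2 *ₚ a)) -ₚ x₁) -ₚ x₂
            y₃ = (k *ₚ (x₁ -ₚ x₃)) -ₚ y₁
        in just (x₃ , y₃)
  ... | yes _ with (y₁ +ₚ y₂) ≟ 0
  ...   | yes _ = nothing
  ...   | no _ =
        let k  = ((x₁ +ₚ a) *ₚ ((3 *ₚ x₁) +ₚ a)) /ₚ (2 *ₚ y₁)
            x₃ = ((k *ₚ k) -ₚ (2 *ₚ a)) -ₚ (2 *ₚ x₁)
            y₃ = (k *ₚ (x₁ -ₚ x₃)) -ₚ y₁
        in just (x₃ , y₃)

  smul : ℕ → ℕ → Point → Point
  smul a zero Q = nothing
  smul a (suc n) Q = add a Q (smul a n Q)

  HasOrder4 : ℕ → Point → Set
  HasOrder4 a Q = (smul a 4 Q ≡ nothing) × (smul a 2 Q ≡ nothing → Data.Empty.⊥)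
    where import Data.Empty

{-# OPTIONS --safe #-}
module Submission where

-- Since a is a square and p ≡ 1 (mod 4), also -a = s² in F_p, so the node of y² = x(x + a)² is split: the
-- nonsingular points are the (u², u(u² + a)) with u ≠ ±s, and sending such a point to (u - s)/(u + s) and ∞ to 1
-- is an isomorphism E(F_p) ≅ F_p^×, as a direct computation with the chord-and-tangent formulas shows. P has
-- parameter t, so its image v = (t - s)/(t + s) = (t² + a)/(t + s)² is a non-square and v^((p-1)/2) = -1 by
-- Euler's criterion. As 8 ∣ p - 1 forces e ≥ 2, the point 2^(e-2) m P is sent to W = v^((p-1)/4) with W² = -1,
-- so it has order 4; and a point (z, w) whose image squares to -1 has u² = a, whence z = a and w/(2a) = u.
-- Fermat's little theorem, Euler's criterion and √-1 ∈ F_p all come from pairing each unit y with b/y.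

open import Defs
open import Data.Nat as ℕ using (ℕ; zero; suc; NonZero)
import Data.Nat.Properties as ℕₚ
open import Data.Nat.DivMod using (_%_; _/_; m≡m%n+[m/n]*n; m%n<n; %-distribˡ-*)
open import Data.Nat.Divisibility using (_∣_; divides; ∣-trans; >⇒∤; *-cancelˡ-∣; n∣m⇒m%n≡0)
open import Data.Nat.GCD using (module Bézout; module GCD; GCD)
open import Data.Nat.Coprimality as Coprime using (coprime⇒GCD≡1; prime⇒coprime)
open import Data.Nat.Primality using (Prime; euclidsLemma; prime⇒nonTrivial)
import Data.Nat.Tactic.RingSolver as ℕ-Solver
import Data.Integer.Properties as ℤₚ
import Data.Integer.Divisibility.Signed as ℤ∣
import Data.Integer.DivMod as ℤDivMod
open import Data.Integer.Tactic.RingSolver using (solve-∀)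
open import Data.Fin using (Fin; toℕ; fromℕ<)
import Data.Fin.Properties as Finₚ
open import Data.List using (List; []; _∷_; length; map; downFrom)
open import Data.List.Properties using (length-map; length-downFrom)
open import Data.List.Membership.Propositional using (_∈_; _∉_)
open import Data.List.Membership.Propositional.Properties using (∈-map⁺; ∈-map⁻; ∈-downFrom⁺; ∈-downFrom⁻)
open import Data.List.Relation.Unary.Any as Any using (here; there)
import Data.List.Relation.Unary.All as All
open import Data.List.Relation.Unary.AllPairs using (_∷_)
open import Data.List.Relation.Unary.Unique.Propositional as Unique using (Unique)
import Data.List.Relation.Unary.Unique.Propositional.Properties as Uniqueₚ
open import Data.Maybe using (just; nothing)
open import Data.Product using (_×_; _,_; ∃-syntax; proj₁; proj₂; uncurry)
open import Data.Sum as Sum using (_⊎_; inj₁; inj₂)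
open import Relation.Binary.Bundles using (Setoid)
open import Relation.Binary.Definitions using (DecidableEquality)
import Relation.Binary.Reasoning.Setoid as SetoidReasoning
open import Relation.Binary.PropositionalEquality using (_≡_; _≢_; refl; sym; trans; cong; subst; module ≡-Reasoning)
open import Function using (_∘_)
open import Relation.Nullary using (¬_; Dec; yes; no; contradiction)
import Relation.Nullary.Decidable as Dec

module Remove {A : Set} (_≟_ : DecidableEquality A) where

  remove : A → List A → List A
  remove x [] = []
  remove x (y ∷ ys) with x ≟ y
  ... | yes _ = ys
  ... | no  _ = y ∷ remove x ys

  ∈-remove⁺ : ∀ {x y} xs → y ∈ xs → y ≢ x → y ∈ remove x xs
  ∈-remove⁺ {x} (z ∷ zs) y∈ y≢x with x ≟ z | y∈
  ... | yes refl | here refl  = contradiction refl y≢x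
  ... | yes refl | there y∈zs = y∈zs
  ... | no  _    | here refl  = here refl
  ... | no  _    | there y∈zs = there (∈-remove⁺ zs y∈zs y≢x)

  ∈-remove⁻ : ∀ {x y} xs → y ∈ remove x xs → y ∈ xs
  ∈-remove⁻ {x} (z ∷ zs) y∈ with x ≟ z | y∈
  ... | yes _ | y∈zs       = there y∈zs
  ... | no  _ | here refl  = here refl
  ... | no  _ | there y∈zs = there (∈-remove⁻ zs y∈zs)

  remove⁺ : ∀ {x} xs → Unique xs → Unique (remove x xs)
  remove⁺ [] u = u
  remove⁺ {x} (z ∷ zs) (z≢zs ∷ u) with x ≟ z
  ... | yes _ = u
  ... | no  _ = All.tabulate (λ w∈ → All.lookup z≢zs (∈-remove⁻ zs w∈)) ∷ remove⁺ zs u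

  ∉-remove : ∀ {x} xs → Unique xs → x ∉ remove x xs
  ∉-remove {x} (z ∷ zs) (z≢zs ∷ u) x∈ with x ≟ z | x∈
  ... | yes refl | x∈zs       = All.lookup z≢zs x∈zs refl
  ... | no  x≢z  | here x≡z   = x≢z x≡z
  ... | no  _    | there x∈zs = ∉-remove zs u x∈zs

  length-remove : ∀ {x} xs → x ∈ xs → suc (length (remove x xs)) ≡ length xs
  length-remove {x} (z ∷ zs) x∈ with x ≟ z | x∈
  ... | yes _   | _          = refl
  ... | no  x≢z | here x≡z   = contradiction x≡z x≢z
  ... | no  _   | there x∈zs = cong suc (length-remove zs x∈zs)

  record InvolutionOn (ι : A → A) (xs : List A) : Set where
    field
      unique     : Unique xs
      closed     : ∀ {y} → y ∈ xs → ι y ∈ xs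
      involutive : ∀ {y} → y ∈ xs → ι (ι y) ≡ y

    injective : ∀ {y z} → y ∈ xs → z ∈ xs → ι y ≡ ι z → y ≡ z
    injective y∈ z∈ ιy≡ιz = trans (sym (involutive y∈)) (trans (cong ι ιy≡ιz) (involutive z∈))

  open InvolutionOn

  InvolutionOn-removeFixed : ∀ {ι x xs} → InvolutionOn ι xs → ι x ≡ x → InvolutionOn ι (remove x xs)
  InvolutionOn-removeFixed {ι} {x} {xs} inv ιx≡x = record
    { unique     = remove⁺ xs (unique inv)
    ; closed     = λ z∈ → ∈-remove⁺ xs (closed inv (∈-remove⁻ xs z∈)) (ιz≢x z∈)
    ; involutive = λ z∈ → involutive inv (∈-remove⁻ xs z∈)
    }
    where
    ιz≢x : ∀ {z} → z ∈ remove x xs → ι z ≢ x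
    ιz≢x {z} z∈ ιz≡x = ∉-remove xs (unique inv) (subst (_∈ remove x xs) z≡x z∈)
      where
      z≡x : z ≡ x
      z≡x = trans (sym (involutive inv (∈-remove⁻ xs z∈))) (trans (cong ι ιz≡x) ιx≡x)

  InvolutionOn-removePair : ∀ {ι y ys} → InvolutionOn ι (y ∷ ys) → ι y ≢ y →
    InvolutionOn ι (remove (ι y) ys)
  InvolutionOn-removePair {ι} {y} {ys} inv ιy≢y = record
    { unique     = remove⁺ ys (Unique.tail (unique inv))
    ; closed     = λ z∈ → ∈-remove⁺ ys (Any.tail (ιz≢y z∈) (closed inv (there (∈-remove⁻ ys z∈)))) (ιz≢ιy z∈)
    ; involutive = λ z∈ → involutive inv (there (∈-remove⁻ ys z∈))
    }
    where
    ιy∈ : ι y ∈ y ∷ ys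
    ιy∈ = closed inv (here refl)
    ιz≢y : ∀ {z} → z ∈ remove (ι y) ys → ι z ≢ y
    ιz≢y {z} z∈ ιz≡y = ∉-remove ys (Unique.tail (unique inv)) (subst (_∈ remove (ι y) ys) z≡ιy z∈)
      where
      z≡ιy : z ≡ ι y
      z≡ιy = injective inv (there (∈-remove⁻ ys z∈)) ιy∈ (trans ιz≡y (sym (involutive inv (here refl))))
    ιz≢ιy : ∀ {z} → z ∈ remove (ι y) ys → ι z ≢ ι y
    ιz≢ιy {z} z∈ ιz≡ιy = Uniqueₚ.Unique[x∷xs]⇒x∉xs (unique inv)
      (subst (_∈ ys) (injective inv (there (∈-remove⁻ ys z∈)) (here refl) ιz≡ιy) (∈-remove⁻ ys z∈))

open Remove ℕₚ._≟_

module ModP (p : ℕ) .{{_ : NonZero p}} where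

  open import Data.Integer using (ℤ; +_; 0ℤ; 1ℤ; _+_; _*_; -_; _-_; _^_; ∣_∣)

  -- A record rather than a type synonym, so that x and y can be inferred from a proof of x ≋ y.
  infix 4 _≋_
  record _≋_ (x y : ℤ) : Set where
    constructor mk≋
    field p∣x-y : + p ℤ∣.∣ x - y

  private
    multiple : ∀ {P Q} c → P ≋ Q → + p ℤ∣.∣ c * (P - Q)
    multiple c (mk≋ d) = ℤ∣.∣n⇒∣m*n c d

  -- When L - R lies in the ideal generated by the differences Pᵢ - Qᵢ, the congruences Pᵢ ≋ Qᵢ yield L ≋ R;
  -- the identity exhibiting the coefficients is discharged by the ring solver at each use.
  ≋-combination₁ : ∀ {L R P Q} c → L - R ≡ c * (P - Q) → P ≋ Q → L ≋ R
  ≋-combination₁ c e h = mk≋ (subst (+ p ℤ∣.∣_) (sym e) (multiple c h))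

  ≋-combination₂ : ∀ {L R P₁ Q₁ P₂ Q₂} c₁ c₂ →
    L - R ≡ c₁ * (P₁ - Q₁) + c₂ * (P₂ - Q₂) → P₁ ≋ Q₁ → P₂ ≋ Q₂ → L ≋ R
  ≋-combination₂ c₁ c₂ e h₁ h₂ =
    mk≋ (subst (+ p ℤ∣.∣_) (sym e) (ℤ∣.∣m∣n⇒∣m+n (multiple c₁ h₁) (multiple c₂ h₂)))

  ≋-combination₃ : ∀ {L R P₁ Q₁ P₂ Q₂ P₃ Q₃} c₁ c₂ c₃ →
    L - R ≡ c₁ * (P₁ - Q₁) + c₂ * (P₂ - Q₂) + c₃ * (P₃ - Q₃) →
    P₁ ≋ Q₁ → P₂ ≋ Q₂ → P₃ ≋ Q₃ → L ≋ R
  ≋-combination₃ c₁ c₂ c₃ e h₁ h₂ h₃ =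
    mk≋ (subst (+ p ℤ∣.∣_) (sym e)
      (ℤ∣.∣m∣n⇒∣m+n (ℤ∣.∣m∣n⇒∣m+n (multiple c₁ h₁) (multiple c₂ h₂)) (multiple c₃ h₃)))

  ≋-combination₄ : ∀ {L R P₁ Q₁ P₂ Q₂ P₃ Q₃ P₄ Q₄} c₁ c₂ c₃ c₄ →
    L - R ≡ c₁ * (P₁ - Q₁) + c₂ * (P₂ - Q₂) + c₃ * (P₃ - Q₃) + c₄ * (P₄ - Q₄) →
    P₁ ≋ Q₁ → P₂ ≋ Q₂ → P₃ ≋ Q₃ → P₄ ≋ Q₄ → L ≋ R
  ≋-combination₄ c₁ c₂ c₃ c₄ e h₁ h₂ h₃ h₄ =
    mk≋ (subst (+ p ℤ∣.∣_) (sym e)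
      (ℤ∣.∣m∣n⇒∣m+n (ℤ∣.∣m∣n⇒∣m+n (ℤ∣.∣m∣n⇒∣m+n (multiple c₁ h₁) (multiple c₂ h₂)) (multiple c₃ h₃))
        (multiple c₄ h₄)))

  ≋-by-multiple : ∀ {x y} q → x ≡ y + q * + p → x ≋ y
  ≋-by-multiple {x} {y} q refl = mk≋ (ℤ∣.divides q (e y q (+ p)))
    where
    e : ∀ y q p → y + q * p - y ≡ q * p
    e = solve-∀

  ≋-reflexive : ∀ {x y} → x ≡ y → x ≋ y
  ≋-reflexive {x} refl = ≋-by-multiple 0ℤ (sym (ℤₚ.+-identityʳ x))

  ≋-refl : ∀ {x} → x ≋ x
  ≋-refl = ≋-reflexive refl

  ≋-sym : ∀ {x y} → x ≋ y → y ≋ x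
  ≋-sym {x} {y} = ≋-combination₁ (- 1ℤ) (e x y)
    where
    e : ∀ x y → y - x ≡ - 1ℤ * (x - y)
    e = solve-∀

  ≋-trans : ∀ {x y z} → x ≋ y → y ≋ z → x ≋ z
  ≋-trans {x} {y} {z} = ≋-combination₂ 1ℤ 1ℤ (e x y z)
    where
    e : ∀ x y z → x - z ≡ 1ℤ * (x - y) + 1ℤ * (y - z)
    e = solve-∀

  ≋-setoid : Setoid _ _
  ≋-setoid = record
    { Carrier = ℤ ; _≈_ = _≋_
    ; isEquivalence = record { refl = ≋-refl ; sym = ≋-sym ; trans = ≋-trans } }

  +-cong : ∀ {x y z w} → x ≋ y → z ≋ w → x + z ≋ y + w
  +-cong {x} {y} {z} {w} = ≋-combination₂ 1ℤ 1ℤ (e x y z w)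
    where
    e : ∀ x y z w → x + z - (y + w) ≡ 1ℤ * (x - y) + 1ℤ * (z - w)
    e = solve-∀

  -‿cong : ∀ {x y} → x ≋ y → - x ≋ - y
  -‿cong {x} {y} = ≋-combination₁ (- 1ℤ) (e x y)
    where
    e : ∀ x y → - x - - y ≡ - 1ℤ * (x - y)
    e = solve-∀

  -‿injective : ∀ {x y} → - x ≋ - y → x ≋ y
  -‿injective {x} {y} = ≋-combination₁ (- 1ℤ) (e x y)
    where
    e : ∀ x y → x - y ≡ - 1ℤ * (- x - - y)
    e = solve-∀

  sub-cong : ∀ {x y z w} → x ≋ y → z ≋ w → x - z ≋ y - w
  sub-cong d₁ d₂ = +-cong d₁ (-‿cong d₂)

  *-cong : ∀ {x y z w} → x ≋ y → z ≋ w → x * z ≋ y * w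
  *-cong {x} {y} {z} {w} = ≋-combination₂ z y (e x y z w)
    where
    e : ∀ x y z w → x * z - y * w ≡ z * (x - y) + y * (z - w)
    e = solve-∀

  ^-cong : ∀ {x y} n → x ≋ y → x ^ n ≋ y ^ n
  ^-cong zero    x≋y = ≋-refl
  ^-cong (suc n) x≋y = *-cong x≋y (^-cong n x≋y)

  p≋0 : + p ≋ 0ℤ
  p≋0 = ≋-by-multiple 1ℤ (sym (trans (ℤₚ.+-identityˡ _) (ℤₚ.*-identityˡ (+ p))))

  %-≋ : ∀ x → + (x % p) ≋ + x
  %-≋ x = ≋-sym (≋-by-multiple (+ (x / p)) (begin
    + x                        ≡⟨ cong +_ (m≡m%n+[m/n]*n x p) ⟩
    + (x % p ℕ.+ x / p ℕ.* p)  ≡⟨ ℤₚ.pos-+ (x % p) (x / p ℕ.* p) ⟩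
    + (x % p) + + (x / p ℕ.* p) ≡⟨ cong (_+_ (+ (x % p))) (ℤₚ.pos-* (x / p) p) ⟩
    + (x % p) + + (x / p) * + p ∎))
    where open ≡-Reasoning

  %ℕ-≋ : ∀ x → x ≋ + (x ℤDivMod.%ℕ p)
  %ℕ-≋ x = ≋-by-multiple (x ℤDivMod./ℕ p) (ℤDivMod.a≡a%ℕn+[a/ℕn]*n x p)

  ≡-mod⇒≋ : ∀ {x y} → x % p ≡ y % p → + x ≋ + y
  ≡-mod⇒≋ {x} {y} eq = ≋-trans (≋-sym (%-≋ x)) (≋-trans (≋-reflexive (cong +_ eq)) (%-≋ y))

  private
    ∣∸⇒≡ : ∀ {m n} → m ℕ.≤ n → n ℕ.< p → p ∣ n ℕ.∸ m → m ≡ n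
    ∣∸⇒≡ {m} {n} m≤n n<p p∣n∸m with ℕₚ.m≤n⇒m<n∨m≡n m≤n
    ... | inj₂ m≡n = m≡n
    ... | inj₁ m<n = contradiction p∣n∸m
          (>⇒∤ {{ℕ.>-nonZero (ℕₚ.m<n⇒0<n∸m m<n)}} (ℕₚ.≤-<-trans (ℕₚ.m∸n≤m n m) n<p))

    ≋⇒≡-≤ : ∀ {m n} → m ℕ.≤ n → n ℕ.< p → + m ≋ + n → m ≡ n
    ≋⇒≡-≤ {m} {n} m≤n n<p (mk≋ d) = ∣∸⇒≡ m≤n n<p (subst (p ∣_) ∣m-n∣≡n∸m (ℤ∣.∣⇒∣ᵤ d))
      where
      ∣m-n∣≡n∸m : ∣ + m - + n ∣ ≡ n ℕ.∸ m
      ∣m-n∣≡n∸m = trans (cong ∣_∣ (ℤₚ.m-n≡m⊖n m n)) (ℤₚ.∣⊖∣-≤ m≤n)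

  ≋⇒≡ : ∀ {m n} → m ℕ.< p → n ℕ.< p → + m ≋ + n → m ≡ n
  ≋⇒≡ {m} {n} m<p n<p m≋n with ℕₚ.≤-total m n
  ... | inj₁ m≤n = ≋⇒≡-≤ m≤n n<p m≋n
  ... | inj₂ n≤m = sym (≋⇒≡-≤ n≤m m<p (≋-sym m≋n))

  ≋⇒≡-mod : ∀ {x y} → + x ≋ + y → x % p ≡ y % p
  ≋⇒≡-mod {x} {y} x≋y = ≋⇒≡ (m%n<n x p) (m%n<n y p) (≋-trans (%-≋ x) (≋-trans x≋y (≋-sym (%-≋ y))))

  open Fp p public

  +ₚ-≋ : ∀ x y → + (x +ₚ y) ≋ + x + + y
  +ₚ-≋ x y = ≋-trans (%-≋ (x ℕ.+ y)) (≋-reflexive (ℤₚ.pos-+ x y))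

  *ₚ-≋ : ∀ x y → + (x *ₚ y) ≋ + x * + y
  *ₚ-≋ x y = ≋-trans (%-≋ (x ℕ.* y)) (≋-reflexive (ℤₚ.pos-* x y))

  ∸-≋ : ∀ {r} → r ℕ.≤ p → + (p ℕ.∸ r) ≋ - + r
  ∸-≋ {r} r≤p = ≋-trans (≋-reflexive p∸r≡p-r) (≋-combination₁ 1ℤ (e (+ p) (+ r)) p≋0)
    where
    p∸r≡p-r : + (p ℕ.∸ r) ≡ + p - + r
    p∸r≡p-r = trans (sym (ℤₚ.⊖-≥ r≤p)) (sym (ℤₚ.m-n≡m⊖n p r))
    e : ∀ p r → p - r - - r ≡ 1ℤ * (p - 0ℤ)
    e = solve-∀

  negₚ-≋ : ∀ x → + (-ₚ x) ≋ - + x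
  negₚ-≋ x = ≋-trans (%-≋ (p ℕ.∸ x % p)) (≋-trans (∸-≋ (ℕₚ.<⇒≤ (m%n<n x p))) (-‿cong (%-≋ x)))

  -ₚ-≋ : ∀ x y → + (x -ₚ y) ≋ + x - + y
  -ₚ-≋ x y = ≋-trans (+ₚ-≋ x (-ₚ y)) (+-cong (≋-refl {+ x}) (negₚ-≋ y))

  +ₚ≡0⇒≋0 : ∀ x y → x +ₚ y ≡ 0 → + x + + y ≋ 0ℤ
  +ₚ≡0⇒≋0 x y x+y≡0 = ≋-trans (≋-sym (+ₚ-≋ x y)) (≋-reflexive (cong +_ x+y≡0))

  +ₚ≢0⇒≉0 : ∀ x y → x +ₚ y ≢ 0 → ¬ (+ x + + y ≋ 0ℤ)
  +ₚ≢0⇒≉0 x y x+y≢0 x+y≋0 = x+y≢0 (≋⇒≡ (m%n<n _ p) (ℕ.>-nonZero⁻¹ p) (≋-trans (+ₚ-≋ x y) x+y≋0))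

  IsSquare⇒∃≋ : ∀ {b} → IsSquare b → ∃[ c ] + c * + c ≋ + b
  IsSquare⇒∃≋ (c , c²≡b) = c , ≋-trans (≋-reflexive (sym (ℤₚ.pos-* c c))) (≡-mod⇒≋ c²≡b)

  ¬IsSquare⇒∄≋ : ∀ {b} → ¬ IsSquare b → ∀ C → ¬ (C * C ≋ + b)
  ¬IsSquare⇒∄≋ {b} ¬□ C C²≋b = ¬□ (r , ≋⇒≡-mod (≋-trans (≋-reflexive (ℤₚ.pos-* r r))
    (≋-trans (*-cong (≋-sym (%ℕ-≋ C)) (≋-sym (%ℕ-≋ C))) C²≋b)))
    where
    r = C ℤDivMod.%ℕ p

  IsSquare? : ∀ b → Dec (IsSquare b)
  IsSquare? b = Dec.map′ from-Fin to-Fin (Finₚ.any? (λ c → (toℕ c ℕ.* toℕ c) % p ℕ.≟ b % p))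
    where
    from-Fin : ∃[ c ] (toℕ {p} c ℕ.* toℕ c) % p ≡ b % p → IsSquare b
    from-Fin (c , c²≡b) = toℕ c , c²≡b
    to-Fin : IsSquare b → ∃[ c ] (toℕ {p} c ℕ.* toℕ c) % p ≡ b % p
    to-Fin (c , c²≡b) = fromℕ< c%p<p , (begin
      (toℕ (fromℕ< c%p<p) ℕ.* toℕ (fromℕ< c%p<p)) % p  ≡⟨ cong (λ r → (r ℕ.* r) % p) (Finₚ.toℕ-fromℕ< c%p<p) ⟩
      (c % p ℕ.* (c % p)) % p                          ≡⟨ %-distribˡ-* c c p ⟨
      (c ℕ.* c) % p                                    ≡⟨ c²≡b ⟩
      b % p                                            ∎)
      where
      open ≡-Reasoning
      c%p<p = m%n<n c p

  pos-^ : ∀ x n → + (x ℕ.^ n) ≡ (+ x) ^ n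
  pos-^ x zero    = refl
  pos-^ x (suc n) = trans (ℤₚ.pos-* x (x ℕ.^ n)) (cong (+ x *_) (pos-^ x n))

  /ₚ-≋ : ∀ x y → + (x /ₚ y) ≋ + x * (+ y) ^ (p ℕ.∸ 2)
  /ₚ-≋ x y = ≋-trans (*ₚ-≋ x (invₚ y))
    (*-cong (≋-refl {+ x}) (≋-trans (%-≋ (y ℕ.^ (p ℕ.∸ 2))) (≋-reflexive (pos-^ y (p ℕ.∸ 2)))))

  ≡+multiple⇒≋ : ∀ {a k b} → a ℕ.+ k ℕ.* p ≡ b → + b ≋ + a
  ≡+multiple⇒≋ {a} {k} refl =
    ≋-by-multiple (+ k) (trans (ℤₚ.pos-+ a (k ℕ.* p)) (cong (_+_ (+ a)) (ℤₚ.pos-* k p)))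

  *-≋0ˡ : ∀ {x} y → x ≋ 0ℤ → x * y ≋ 0ℤ
  *-≋0ˡ y x≋0 = ≋-trans (*-cong x≋0 (≋-refl {y})) (≋-reflexive (ℤₚ.*-zeroˡ y))

  *-≋0ʳ : ∀ x {y} → y ≋ 0ℤ → x * y ≋ 0ℤ
  *-≋0ʳ x y≋0 = ≋-trans (*-cong (≋-refl {x}) y≋0) (≋-reflexive (ℤₚ.*-zeroʳ x))

  ≋1⇒*-identityˡ : ∀ {w} x → w ≋ 1ℤ → w * x ≋ x
  ≋1⇒*-identityˡ x w≋1 = ≋-trans (*-cong w≋1 (≋-refl {x})) (≋-reflexive (ℤₚ.*-identityˡ x))

  ≋1⇒*-identityʳ : ∀ x {w} → w ≋ 1ℤ → x * w ≋ x
  ≋1⇒*-identityʳ x w≋1 = ≋-trans (*-cong (≋-refl {x}) w≋1) (≋-reflexive (ℤₚ.*-identityʳ x))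

  infix 4 _≉0
  _≉0 : ℤ → Set
  x ≉0 = ¬ (x ≋ 0ℤ)

  ≋-pres-≉0 : ∀ {x y} → x ≋ y → x ≉0 → y ≉0
  ≋-pres-≉0 x≋y x≉0 y≋0 = x≉0 (≋-trans x≋y y≋0)

  pos-≉0 : ∀ {y} → 0 ℕ.< y → y ℕ.< p → + y ≉0
  pos-≉0 {y} 0<y y<p y≋0 = ℕₚ.<-irrefl (sym (≋⇒≡ y<p (ℕ.>-nonZero⁻¹ p) y≋0)) 0<y

  ≉0-*ˡ : ∀ {x y} → x * y ≉0 → x ≉0
  ≉0-*ˡ {x} {y} xy≉0 x≋0 = xy≉0 (*-≋0ˡ y x≋0)

  ≉0-*ʳ : ∀ {x y} → x * y ≉0 → y ≉0
  ≉0-*ʳ {x} {y} xy≉0 y≋0 = xy≉0 (*-≋0ʳ x y≋0)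

  ∏ : List ℕ → ℤ
  ∏ []       = 1ℤ
  ∏ (x ∷ xs) = + x * ∏ xs

  ∏-remove : ∀ {x} xs → x ∈ xs → ∏ xs ≡ + x * ∏ (remove x xs)
  ∏-remove {x} (z ∷ zs) x∈ with x ℕₚ.≟ z | x∈
  ... | yes refl | _          = refl
  ... | no  x≢z  | here x≡z   = contradiction x≡z x≢z
  ... | no  _    | there x∈zs = trans (cong (+ z *_) (∏-remove zs x∈zs)) (e (+ z) (+ x) (∏ (remove x zs)))
    where
    e : ∀ z x r → z * (x * r) ≡ x * (z * r)
    e = solve-∀

  ∏-pairing : ∀ {b ι} k xs → InvolutionOn ι xs → (∀ {y} → y ∈ xs → ι y ≢ y) →
    (∀ {y} → y ∈ xs → + y * + ι y ≋ b) → length xs ≡ 2 ℕ.* k → ∏ xs ≋ b ^ k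
  ∏-pairing zero    []       _   _    _    _   = ≋-refl
  ∏-pairing (suc k) []       _   _    _    ()
  ∏-pairing zero    (y ∷ ys) _   _    _    ()
  ∏-pairing {b} {ι} (suc k) (y ∷ ys) inv free prod len = begin
    + y * ∏ ys                   ≡⟨ cong (+ y *_) (∏-remove ys ιy∈ys) ⟩
    + y * (+ ι y * ∏ ys′)        ≡⟨ ℤₚ.*-assoc (+ y) (+ ι y) (∏ ys′) ⟨
    + y * + ι y * ∏ ys′          ≈⟨ *-cong (prod (here refl)) ih ⟩
    b * b ^ k                    ∎
    where
    open SetoidReasoning ≋-setoid
    ιy∈ys : ι y ∈ ys
    ιy∈ys = Any.tail (free (here refl)) (InvolutionOn.closed inv (here refl))
    ys′ = remove (ι y) ys
    ih : ∏ ys′ ≋ b ^ k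
    ih = ∏-pairing k ys′ (InvolutionOn-removePair inv (free (here refl)))
      (λ z∈ → free (there (∈-remove⁻ ys z∈))) (λ z∈ → prod (there (∈-remove⁻ ys z∈)))
      (ℕₚ.suc-injective (ℕₚ.suc-injective
        (trans (cong suc (length-remove ys ιy∈ys)) (trans len (ℕₚ.*-suc 2 k)))))

module PrimeField (p : ℕ) .{{_ : NonZero p}} (p-prime : Prime p) where

  open import Data.Integer using (ℤ; +_; 0ℤ; 1ℤ; _+_; _*_; -_; _-_; ∣_∣)
  open ModP p

  *≋0⇒≋0⊎≋0 : ∀ {x y} → x * y ≋ 0ℤ → x ≋ 0ℤ ⊎ y ≋ 0ℤ
  *≋0⇒≋0⊎≋0 {x} {y} xy≋0 = Sum.map ∣⇒≋0 ∣⇒≋0 (euclidsLemma ∣ x ∣ ∣ y ∣ p-prime p∣∣xy∣)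
    where
    ≋0⇔∣ : ∀ z → z - 0ℤ ≡ z
    ≋0⇔∣ = ℤₚ.+-identityʳ
    ∣⇒≋0 : ∀ {z} → p ∣ ∣ z ∣ → z ≋ 0ℤ
    ∣⇒≋0 {z} d = mk≋ (subst (+ p ℤ∣.∣_) (sym (≋0⇔∣ z)) (ℤ∣.∣ᵤ⇒∣ d))
    p∣∣xy∣ : p ∣ ∣ x ∣ ℕ.* ∣ y ∣
    p∣∣xy∣ = subst (p ∣_) (ℤₚ.abs-* x y)
      (subst (λ z → p ∣ ∣ z ∣) (≋0⇔∣ (x * y)) (ℤ∣.∣⇒∣ᵤ (_≋_.p∣x-y xy≋0)))

  *-≉0 : ∀ {x y} → x ≉0 → y ≉0 → x * y ≉0
  *-≉0 x≉0 y≉0 xy≋0 = Sum.[ x≉0 , y≉0 ]′ (*≋0⇒≋0⊎≋0 xy≋0)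

  private
    -≋0⇒≋ : ∀ {x y} → x - y ≋ 0ℤ → x ≋ y
    -≋0⇒≋ {x} {y} = ≋-combination₁ 1ℤ (e x y)
      where
      e : ∀ x y → x - y ≡ 1ℤ * (x - y - 0ℤ)
      e = solve-∀

  *-cancelˡ-≋ : ∀ {a x y} → a ≉0 → a * x ≋ a * y → x ≋ y
  *-cancelˡ-≋ {a} {x} {y} a≉0 ax≋ay =
    Sum.[ (λ a≋0 → contradiction a≋0 a≉0) , -≋0⇒≋ ]′ (*≋0⇒≋0⊎≋0 (≋-combination₁ 1ℤ (e a x y) ax≋ay))
    where
    e : ∀ a x y → a * (x - y) - 0ℤ ≡ 1ℤ * (a * x - a * y)
    e = solve-∀

  x²≋y²⇒x≋±y : ∀ {x y} → x * x ≋ y * y → x ≋ y ⊎ x ≋ - y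
  x²≋y²⇒x≋±y {x} {y} x²≋y² = Sum.map -≋0⇒≋ (λ x+y≋0 → -≋0⇒≋ (≋-trans (≋-reflexive (e₂ x y)) x+y≋0))
    (*≋0⇒≋0⊎≋0 (≋-combination₁ 1ℤ (e₁ x y) x²≋y²))
    where
    e₁ : ∀ x y → (x - y) * (x + y) - 0ℤ ≡ 1ℤ * (x * x - y * y)
    e₁ = solve-∀
    e₂ : ∀ x y → x - - y ≡ x + y
    e₂ = solve-∀

  private
    gcd[y,p]≡1 : ∀ {y} → 0 ℕ.< y → y ℕ.< p → GCD y p 1
    gcd[y,p]≡1 {suc _} _ y<p = coprime⇒GCD≡1 (Coprime.sym (prime⇒coprime p-prime y<p))

  -- An inverse given by Bézout's identity: invₚ from Defs is only known to be an inverse once Fermat's little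
  -- theorem is proved, and that proof needs inverses.
  opaque
    invᴮ : ℕ → ℕ
    invᴮ y with Bézout.lemma y p
    ... | Bézout.result _ _ (Bézout.+- x _ _) = x % p
    ... | Bézout.result _ _ (Bézout.-+ x _ _) = -ₚ x

    invᴮ-inverse : ∀ {y} → 0 ℕ.< y → y ℕ.< p → + y * + invᴮ y ≋ 1ℤ
    invᴮ-inverse {y} 0<y y<p with Bézout.lemma y p
    ... | Bézout.result _ g (Bézout.+- x k 1+kp≡xy) with GCD.unique g (gcd[y,p]≡1 0<y y<p)
    ...   | refl = begin
      + y * + (x % p)    ≈⟨ *-cong (≋-refl {+ y}) (%-≋ x) ⟩
      + y * + x          ≡⟨ ℤₚ.*-comm (+ y) (+ x) ⟩
      + x * + y          ≡⟨ ℤₚ.pos-* x y ⟨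
      + (x ℕ.* y)        ≈⟨ ≡+multiple⇒≋ {1} {k} 1+kp≡xy ⟩
      1ℤ                 ∎
      where open SetoidReasoning ≋-setoid
    invᴮ-inverse {y} 0<y y<p | Bézout.result _ g (Bézout.-+ x k 1+xy≡kp) with GCD.unique g (gcd[y,p]≡1 0<y y<p)
    ...   | refl = begin
      + y * + (-ₚ x)             ≈⟨ *-cong (≋-refl {+ y}) (negₚ-≋ x) ⟩
      + y * - + x                ≡⟨ e (+ x) (+ y) ⟩
      1ℤ - (1ℤ + + x * + y)      ≡⟨ cong (λ z → 1ℤ - (1ℤ + z)) (ℤₚ.pos-* x y) ⟨
      1ℤ - (1ℤ + + (x ℕ.* y))    ≡⟨ cong (_-_ 1ℤ) (ℤₚ.pos-+ 1 (x ℕ.* y)) ⟨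
      1ℤ - + (1 ℕ.+ x ℕ.* y)     ≈⟨ sub-cong (≋-refl {1ℤ}) (≡+multiple⇒≋ {0} {k} (sym 1+xy≡kp)) ⟩
      1ℤ - 0ℤ                    ≡⟨⟩
      1ℤ                         ∎
      where
      open SetoidReasoning ≋-setoid
      e : ∀ x y → y * - x ≡ 1ℤ - (1ℤ + x * y)
      e = solve-∀

module OddPrime (p : ℕ) .{{_ : NonZero p}} (p-prime : Prime p) (q : ℕ) (p≡1+2q : p ≡ suc (2 ℕ.* q)) where

  open import Data.Integer using (ℤ; +_; 0ℤ; 1ℤ; _+_; _*_; -_; _-_; _^_)
  open ModP p
  open PrimeField p p-prime

  p∸1≡2q : p ℕ.∸ 1 ≡ 2 ℕ.* q
  p∸1≡2q = cong ℕ.pred p≡1+2q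

  2<p : 2 ℕ.< p
  2<p = ℕₚ.≤∧≢⇒< (ℕ.nonTrivial⇒n>1 p {{prime⇒nonTrivial p-prime}})
    (λ 2≡p → ℕₚ.even≢odd 1 q (trans 2≡p p≡1+2q))

  q≡1+[q∸1] : q ≡ suc (q ℕ.∸ 1)
  q≡1+[q∸1] = sym (ℕₚ.suc-pred q {{ℕ.>-nonZero (ℕₚ.n≢0⇒n>0 q≢0)}})
    where
    q≢0 : q ≢ 0
    q≢0 q≡0 = ℕₚ.<⇒≱ 2<p (ℕₚ.≤-trans (ℕₚ.≤-reflexive p≡1) (ℕₚ.n≤1+n 1))
      where
      p≡1 : p ≡ 1
      p≡1 = trans p≡1+2q (cong (λ n → suc (2 ℕ.* n)) q≡0)

  2≉0 : + 2 ≉0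
  2≉0 = pos-≉0 ℕ.z<s 2<p

  p∸1≋-1 : + (p ℕ.∸ 1) ≋ - 1ℤ
  p∸1≋-1 = ∸-≋ (ℕ.>-nonZero⁻¹ p)

  1≉-1 : ¬ (1ℤ ≋ - 1ℤ)
  1≉-1 1≋-1 = 2≉0 (≋-combination₁ 1ℤ refl 1≋-1)

  units : List ℕ
  units = map suc (downFrom (p ℕ.∸ 1))

  ∈-units⁺ : ∀ {y} → 0 ℕ.< y → y ℕ.< p → y ∈ units
  ∈-units⁺ {suc y} _ y<p = ∈-map⁺ suc (∈-downFrom⁺ (ℕₚ.∸-monoˡ-≤ 1 y<p))

  ∈-units⁻ : ∀ {y} → y ∈ units → 0 ℕ.< y × y ℕ.< p
  ∈-units⁻ y∈ with ∈-map⁻ suc y∈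
  ... | x , x∈ , refl = ℕ.z<s , subst (suc x ℕ.<_) suc[p∸1]≡p (ℕ.s<s (∈-downFrom⁻ x∈))
    where
    suc[p∸1]≡p : suc (p ℕ.∸ 1) ≡ p
    suc[p∸1]≡p = trans (cong suc p∸1≡2q) (sym p≡1+2q)

  units-≉0 : ∀ {y} → y ∈ units → + y ≉0
  units-≉0 y∈ = uncurry pos-≉0 (∈-units⁻ y∈)

  ≋⇒≡-units : ∀ {y z} → y ∈ units → z ∈ units → + y ≋ + z → y ≡ z
  ≋⇒≡-units y∈ z∈ = ≋⇒≡ (proj₂ (∈-units⁻ y∈)) (proj₂ (∈-units⁻ z∈))

  ≉0⇒∈-units : ∀ {y} → y ℕ.< p → + y ≉0 → y ∈ units
  ≉0⇒∈-units {zero}  _   0≉0 = contradiction ≋-refl 0≉0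
  ≉0⇒∈-units {suc y} y<p _   = ∈-units⁺ ℕ.z<s y<p

  length-units : length units ≡ 2 ℕ.* q
  length-units = trans (length-map suc (downFrom (p ℕ.∸ 1))) (trans (length-downFrom (p ℕ.∸ 1)) p∸1≡2q)

  unique-units : Unique units
  unique-units = Uniqueₚ.map⁺ ℕₚ.suc-injective (Uniqueₚ.downFrom⁺ (p ℕ.∸ 1))

  neg-units : ∀ {r} → r ∈ units → p ℕ.∸ r ∈ units
  neg-units {r} r∈ = ≉0⇒∈-units (ℕₚ.∸-monoʳ-< (proj₁ (∈-units⁻ r∈)) (ℕₚ.<⇒≤ r<p))
    (λ p∸r≋0 → units-≉0 r∈ (≋-trans (≋-sym (≋-reflexive (ℤₚ.neg-involutive (+ r))))
      (-‿cong (≋-trans (≋-sym (∸-≋ (ℕₚ.<⇒≤ r<p))) p∸r≋0))))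
    where
    r<p = proj₂ (∈-units⁻ r∈)

  neg-units-≢ : ∀ {r} → r ∈ units → p ℕ.∸ r ≢ r
  neg-units-≢ {r} r∈ p∸r≡r = ℕₚ.even≢odd r q (begin
    2 ℕ.* r          ≡⟨ cong (r ℕ.+_) (ℕₚ.+-identityʳ r) ⟩
    r ℕ.+ r          ≡⟨ cong (ℕ._+ r) p∸r≡r ⟨
    p ℕ.∸ r ℕ.+ r    ≡⟨ ℕₚ.m∸n+n≡m (ℕₚ.<⇒≤ (proj₂ (∈-units⁻ r∈))) ⟩
    p                ≡⟨ p≡1+2q ⟩
    suc (2 ℕ.* q)    ∎)
    where open ≡-Reasoning

  module Pairing {b : ℕ} (b∈ : b ∈ units) where

    ι : ℕ → ℕ
    ι y = b *ₚ invᴮ y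

    ι-product : ∀ {y} → y ∈ units → + y * + ι y ≋ + b
    ι-product {y} y∈ = begin
      + y * + (b *ₚ invᴮ y)   ≈⟨ *-cong (≋-refl {+ y}) (*ₚ-≋ b (invᴮ y)) ⟩
      + y * (+ b * + invᴮ y)  ≡⟨ e (+ y) (+ b) (+ invᴮ y) ⟩
      + b * (+ y * + invᴮ y)  ≈⟨ *-cong (≋-refl {+ b}) (uncurry invᴮ-inverse (∈-units⁻ y∈)) ⟩
      + b * 1ℤ                ≡⟨ ℤₚ.*-identityʳ (+ b) ⟩
      + b                     ∎
      where
      open SetoidReasoning ≋-setoid
      e : ∀ y b i → y * (b * i) ≡ b * (y * i)
      e = solve-∀

    ι-units : ∀ {y} → y ∈ units → ι y ∈ units
    ι-units {y} y∈ = ≉0⇒∈-units (m%n<n _ p) (λ ιy≋0 → units-≉0 b∈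
      (≋-trans (≋-sym (ι-product y∈)) (*-≋0ʳ (+ y) ιy≋0)))

    ι-fixed⇒square : ∀ {y} → y ∈ units → ι y ≡ y → + y * + y ≋ + b
    ι-fixed⇒square {y} y∈ ιy≡y = subst (λ z → + y * + z ≋ + b) ιy≡y (ι-product y∈)

    square⇒ι-fixed : ∀ {y} → y ∈ units → + y * + y ≋ + b → ι y ≡ y
    square⇒ι-fixed y∈ y²≋b = ≋⇒≡-units (ι-units y∈) y∈
      (*-cancelˡ-≋ (units-≉0 y∈) (≋-trans (ι-product y∈) (≋-sym y²≋b)))

    ι-involutive : ∀ {y} → y ∈ units → ι (ι y) ≡ y
    ι-involutive {y} y∈ = ≋⇒≡-units (ι-units ιy∈) y∈ (*-cancelˡ-≋ (units-≉0 ιy∈) (begin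
      + ι y * + ι (ι y)    ≈⟨ ι-product ιy∈ ⟩
      + b                  ≈⟨ ι-product y∈ ⟨
      + y * + ι y          ≡⟨ ℤₚ.*-comm (+ y) (+ ι y) ⟩
      + ι y * + y          ∎))
      where
      open SetoidReasoning ≋-setoid
      ιy∈ = ι-units y∈

    ι-involution : InvolutionOn ι units
    ι-involution = record { unique = unique-units ; closed = ι-units ; involutive = ι-involutive }

    ∏-units-nonsquare : (∀ {y} → y ∈ units → ¬ (+ y * + y ≋ + b)) → ∏ units ≋ (+ b) ^ q
    ∏-units-nonsquare nonsquare = ∏-pairing {+ b} {ι} q units ι-involution
      (λ y∈ ιy≡y → nonsquare y∈ (ι-fixed⇒square y∈ ιy≡y)) ι-product length-units

    ∏-units-square : ∀ {r} → r ∈ units → + r * + r ≋ + b → ∏ units ≋ - (+ b) ^ q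
    ∏-units-square {r} r∈ r²≋b = begin
      ∏ units                       ≡⟨ ∏-remove units r∈ ⟩
      + r * ∏ xs₁                   ≡⟨ cong (+ r *_) (∏-remove xs₁ s∈xs₁) ⟩
      + r * (+ s * ∏ xs₂)           ≈⟨ *-cong (≋-refl {+ r}) (*-cong s≋-r ∏xs₂≋bᵏ) ⟩
      + r * (- + r * (+ b) ^ k)     ≡⟨ e (+ r) ((+ b) ^ k) ⟩
      - (+ r * + r * (+ b) ^ k)     ≈⟨ -‿cong (*-cong r²≋b (≋-refl {(+ b) ^ k})) ⟩
      - (+ b) ^ suc k               ≡⟨ cong (λ n → - (+ b) ^ n) (sym q≡1+[q∸1]) ⟩
      - (+ b) ^ q                   ∎
      where
      open SetoidReasoning ≋-setoid
      e : ∀ r x → r * (- r * x) ≡ - (r * r * x)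
      e = solve-∀
      s = p ℕ.∸ r
      k = q ℕ.∸ 1
      xs₁ = remove r units
      xs₂ = remove s xs₁
      s≋-r : + s ≋ - + r
      s≋-r = ∸-≋ (ℕₚ.<⇒≤ (proj₂ (∈-units⁻ r∈)))
      s∈xs₁ : s ∈ xs₁
      s∈xs₁ = ∈-remove⁺ units (neg-units r∈) (neg-units-≢ r∈)
      s²≋b : + s * + s ≋ + b
      s²≋b = ≋-trans (*-cong s≋-r s≋-r) (≋-trans (≋-reflexive (e′ (+ r))) r²≋b)
        where
        e′ : ∀ r → - r * - r ≡ r * r
        e′ = solve-∀
      inv₂ : InvolutionOn ι xs₂
      inv₂ = InvolutionOn-removeFixed (InvolutionOn-removeFixed ι-involution (square⇒ι-fixed r∈ r²≋b))
        (square⇒ι-fixed (neg-units r∈) s²≋b)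
      ∈xs₂⇒∈units : ∀ {y} → y ∈ xs₂ → y ∈ units
      ∈xs₂⇒∈units y∈ = ∈-remove⁻ units (∈-remove⁻ xs₁ y∈)
      fixed-point-free : ∀ {y} → y ∈ xs₂ → ι y ≢ y
      fixed-point-free {y} y∈ ιy≡y = Sum.[ y≉r , y≉-r ]′ (x²≋y²⇒x≋±y y²≋r²)
        where
        y∈units = ∈xs₂⇒∈units y∈
        y²≋r² = ≋-trans (ι-fixed⇒square y∈units ιy≡y) (≋-sym r²≋b)
        y≉r : ¬ (+ y ≋ + r)
        y≉r y≋r = ∉-remove units unique-units
          (subst (_∈ xs₁) (≋⇒≡-units y∈units r∈ y≋r) (∈-remove⁻ xs₁ y∈))
        y≉-r : ¬ (+ y ≋ - + r)
        y≉-r y≋-r = ∉-remove xs₁ (remove⁺ units unique-units)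
          (subst (_∈ xs₂) (≋⇒≡-units y∈units (neg-units r∈) (≋-trans y≋-r (≋-sym s≋-r))) y∈)
      length-xs₂ : length xs₂ ≡ 2 ℕ.* k
      length-xs₂ = ℕₚ.suc-injective (ℕₚ.suc-injective
        (trans (cong suc (length-remove xs₁ s∈xs₁)) (trans (length-remove units r∈)
          (trans length-units (trans (cong (2 ℕ.*_) q≡1+[q∸1]) (ℕₚ.*-suc 2 k))))))
      ∏xs₂≋bᵏ : ∏ xs₂ ≋ (+ b) ^ k
      ∏xs₂≋bᵏ = ∏-pairing {+ b} {ι} k xs₂ inv₂ fixed-point-free (ι-product ∘ ∈xs₂⇒∈units) length-xs₂

  1∈units : 1 ∈ units
  1∈units = ∈-units⁺ ℕ.z<s (ℕₚ.<-trans (ℕₚ.n<1+n 1) 2<p)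

  wilson : ∏ units ≋ - 1ℤ
  wilson = ≋-trans (Pairing.∏-units-square 1∈units 1∈units ≋-refl) (≋-reflexive (cong -_ (ℤₚ.^-zeroˡ q)))

  private
    %ℕ-units : ∀ {x} → x ≉0 → x ℤDivMod.%ℕ p ∈ units
    %ℕ-units {x} x≉0 = ≉0⇒∈-units (ℤDivMod.n%ℕd<d x p) (λ r≋0 → x≉0 (≋-trans (%ℕ-≋ x) r≋0))

    fermat-units : ∀ {x} → x ∈ units → (+ x) ^ (p ℕ.∸ 1) ≋ 1ℤ
    fermat-units {x} x∈ = -‿injective (begin
      - (+ x) ^ (p ℕ.∸ 1)      ≡⟨ cong (λ n → - (+ x) ^ n) p∸1≡2q ⟩
      - (+ x) ^ (2 ℕ.* q)      ≡⟨ cong -_ (sym (ℤₚ.^-*-assoc (+ x) 2 q)) ⟩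
      - ((+ x) ^ 2) ^ q        ≡⟨ cong (λ y → - y ^ q) (cong (+ x *_) (ℤₚ.*-identityʳ (+ x))) ⟩
      - (+ x * + x) ^ q        ≈⟨ -‿cong (^-cong q (≋-sym (*ₚ-≋ x x))) ⟩
      - (+ (x *ₚ x)) ^ q       ≈⟨ ∏-units-square x∈ (≋-sym (*ₚ-≋ x x)) ⟨
      ∏ units                  ≈⟨ wilson ⟩
      - 1ℤ                     ∎)
      where
      open SetoidReasoning ≋-setoid
      x²∈units : x *ₚ x ∈ units
      x²∈units = ≉0⇒∈-units (m%n<n _ p)
        (λ x²≋0 → *-≉0 (units-≉0 x∈) (units-≉0 x∈) (≋-trans (≋-sym (*ₚ-≋ x x)) x²≋0))
      open Pairing x²∈units using (∏-units-square)

  fermat : ∀ {x} → x ≉0 → x ^ (p ℕ.∸ 1) ≋ 1ℤ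
  fermat {x} x≉0 = ≋-trans (^-cong (p ℕ.∸ 1) (%ℕ-≋ x)) (fermat-units (%ℕ-units x≉0))

  *-inverse : ∀ {x} → x ≉0 → x * x ^ (p ℕ.∸ 2) ≋ 1ℤ
  *-inverse {x} x≉0 = subst (λ n → x ^ n ≋ 1ℤ) p∸1≡1+[p∸2] (fermat x≉0)
    where
    p∸1≡1+[p∸2] : p ℕ.∸ 1 ≡ suc (p ℕ.∸ 2)
    p∸1≡1+[p∸2] = ℕₚ.+-∸-assoc 1 (ℕₚ.<⇒≤ 2<p)

  /ₚ-*-≋ : ∀ y d → + d ≉0 → + (y /ₚ d) * + d ≋ + y
  /ₚ-*-≋ y d d≉0 = begin
    + (y /ₚ d) * + d                  ≈⟨ *-cong (/ₚ-≋ y d) (≋-refl {+ d}) ⟩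
    + y * (+ d) ^ (p ℕ.∸ 2) * + d     ≡⟨ e (+ y) ((+ d) ^ (p ℕ.∸ 2)) (+ d) ⟩
    + y * (+ d * (+ d) ^ (p ℕ.∸ 2))   ≈⟨ *-cong (≋-refl {+ y}) (*-inverse d≉0) ⟩
    + y * 1ℤ                          ≡⟨ ℤₚ.*-identityʳ (+ y) ⟩
    + y                               ∎
    where
    open SetoidReasoning ≋-setoid
    e : ∀ y i d → y * i * d ≡ y * (d * i)
    e = solve-∀

  euler : ∀ {x} → x ≉0 → (∀ c → ¬ (c * c ≋ x)) → x ^ q ≋ - 1ℤ
  euler {x} x≉0 nonsquare = begin
    x ^ q                 ≈⟨ ^-cong q (%ℕ-≋ x) ⟩
    (+ r) ^ q             ≈⟨ ∏-units-nonsquare r-nonsquare ⟨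
    ∏ units               ≈⟨ wilson ⟩
    - 1ℤ                  ∎
    where
    open SetoidReasoning ≋-setoid
    r = x ℤDivMod.%ℕ p
    open Pairing (%ℕ-units x≉0) using (∏-units-nonsquare)
    r-nonsquare : ∀ {y} → y ∈ units → ¬ (+ y * + y ≋ + r)
    r-nonsquare {y} _ y²≋r = nonsquare (+ y) (≋-trans y²≋r (≋-sym (%ℕ-≋ x)))

  √-1 : ∀ j → q ≡ 2 ℕ.* j → ∃[ i ] i * i ≋ - 1ℤ
  √-1 j q≡2j with IsSquare? (p ℕ.∸ 1)
  ... | yes □ = + c , ≋-trans c²≋p∸1 p∸1≋-1
    where
    c = proj₁ (IsSquare⇒∃≋ □)
    c²≋p∸1 = proj₂ (IsSquare⇒∃≋ □)
  ... | no ¬□ = contradiction 1≋-1 1≉-1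
    where
    1≋-1 : 1ℤ ≋ - 1ℤ
    1≋-1 = begin
      1ℤ                       ≡⟨ ℤₚ.^-zeroˡ j ⟨
      ((- 1ℤ) ^ 2) ^ j         ≡⟨ ℤₚ.^-*-assoc (- 1ℤ) 2 j ⟩
      (- 1ℤ) ^ (2 ℕ.* j)       ≡⟨ cong ((- 1ℤ) ^_) q≡2j ⟨
      (- 1ℤ) ^ q               ≈⟨ euler -1≉0 (λ c c²≋-1 → ¬IsSquare⇒∄≋ ¬□ c (≋-trans c²≋-1 (≋-sym p∸1≋-1))) ⟩
      - 1ℤ                     ∎
      where
      open SetoidReasoning ≋-setoid
      -1≉0 : - 1ℤ ≉0
      -1≉0 -1≋0 = pos-≉0 ℕ.z<s (ℕₚ.<-trans (ℕₚ.n<1+n 1) 2<p) (-‿injective -1≋0)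

  √-a : ∀ j → q ≡ 2 ℕ.* j → ∀ {a} → IsSquare a → ∃[ s ] s * s ≋ - + a
  √-a j q≡2j {a} a-square = i * + c , (begin
    i * + c * (i * + c)     ≡⟨ e i (+ c) ⟩
    i * i * (+ c * + c)     ≈⟨ *-cong i²≋-1 c²≋a ⟩
    - 1ℤ * + a              ≡⟨ ℤₚ.-1*i≡-i (+ a) ⟩
    - + a                   ∎)
    where
    open SetoidReasoning ≋-setoid
    i = proj₁ (√-1 j q≡2j)
    i²≋-1 = proj₂ (√-1 j q≡2j)
    c = proj₁ (IsSquare⇒∃≋ a-square)
    c²≋a = proj₂ (IsSquare⇒∃≋ a-square)
    e : ∀ i c → i * c * (i * c) ≡ i * i * (c * c)
    e = solve-∀

  module SplitNode (a : ℕ) (s : ℤ) (s²≋-a : s * s ≋ - + a) (a≉0 : + a ≉0) where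

    A : ℤ
    A = + a

    record Parametrised (x y : ℕ) (w : ℤ) : Set where
      constructor param
      field
        u           : ℤ
        x≋u²        : + x ≋ u * u
        y≋u[u²+A]   : + y ≋ u * (u * u + A)
        w[u+s]≋u-s  : w * (u + s) ≋ u - s
        w≉0         : w ≉0

    -- w is the image of R under E(F_p) ≅ F_p^×, stated as a relation so that the parameter u is never computed.
    infix 4 _↦_
    _↦_ : Point → ℤ → Set
    nothing      ↦ w = w ≋ 1ℤ
    just (x , y) ↦ w = x ℕ.< p × Parametrised x y w

    ↦-resp-≋ : ∀ R {w w′} → w ≋ w′ → R ↦ w → R ↦ w′
    ↦-resp-≋ nothing      w≋w′ w≋1 = ≋-trans (≋-sym w≋w′) w≋1
    ↦-resp-≋ (just _) {w} {w′} w≋w′ (x<p , param u x≋ y≋ w≋ w≉0) =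
      x<p , param u x≋ y≋ (≋-trans (*-cong (≋-sym w≋w′) (≋-refl {u + s})) w≋) (≋-pres-≉0 w≋w′ w≉0)

    s≉0 : s ≉0
    s≉0 s≋0 = a≉0 (-‿injective (≋-trans (≋-sym s²≋-a) (*-≋0ˡ s s≋0)))

    u²+A≋[u-s][u+s] : ∀ u → u * u + A ≋ (u - s) * (u + s)
    u²+A≋[u-s][u+s] u = ≋-combination₁ 1ℤ (e u s A) s²≋-a
      where
      e : ∀ u s A → u * u + A - (u - s) * (u + s) ≡ 1ℤ * (s * s - - A)
      e = solve-∀

    module _ {x y w} (P : Parametrised x y w) where
      open Parametrised P

      u+s≉0 : u + s ≉0
      u+s≉0 u+s≋0 = *-≉0 2≉0 s≉0 (≋-combination₂ 1ℤ (- 1ℤ) (e u s) u+s≋0 u-s≋0)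
        where
        u-s≋0 : u - s ≋ 0ℤ
        u-s≋0 = ≋-trans (≋-sym w[u+s]≋u-s) (*-≋0ʳ w u+s≋0)
        e : ∀ u s → + 2 * s - 0ℤ ≡ 1ℤ * (u + s - 0ℤ) + - 1ℤ * (u - s - 0ℤ)
        e = solve-∀

      u-s≉0 : u - s ≉0
      u-s≉0 u-s≋0 = *-≉0 w≉0 u+s≉0 (≋-trans w[u+s]≋u-s u-s≋0)

      u²+A≉0 : u * u + A ≉0
      u²+A≉0 u²+A≋0 = *-≉0 u-s≉0 u+s≉0 (≋-trans (≋-sym (u²+A≋[u-s][u+s] u)) u²+A≋0)

    N : ℤ → ℤ → ℤ
    N u₁ u₂ = u₁ * u₁ + u₁ * u₂ + u₂ * u₂ + A

    -- If K (u₁ + u₂) ≋ N u₁ u₂, the line of slope K through the point with parameter u₁ also passes through (for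
    -- u₁ = u₂: is tangent at) the point with parameter u₂, and meets the cubic a third time at parameter
    -- K - u₁ - u₂; so the sum of the two points has parameter u₁ + u₂ - K.
    third-point : ∀ {x₃ y₃} (K u₁ u₂ w₁ w₂ : ℤ) →
      w₁ * (u₁ + s) ≋ u₁ - s → w₂ * (u₂ + s) ≋ u₂ - s → w₁ ≉0 → w₂ ≉0 →
      u₁ + u₂ ≉0 → K * (u₁ + u₂) ≋ N u₁ u₂ → x₃ ℕ.< p →
      + x₃ ≋ K * K - + 2 * A - u₁ * u₁ - u₂ * u₂ →
      + y₃ ≋ K * (u₁ * u₁ - + x₃) - u₁ * (u₁ * u₁ + A) →
      just (x₃ , y₃) ↦ w₁ * w₂
    third-point {x₃} {y₃} K u₁ u₂ w₁ w₂ w₁≋ w₂≋ w₁≉0 w₂≉0 u₁+u₂≉0 on-line x₃<p x₃≋ y₃≋ =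
      x₃<p , param u₃ x₃≋u₃² y₃≋u₃³+Au₃ (*-cancelˡ-≋ u₁+u₂≉0 w≋) (*-≉0 w₁≉0 w₂≉0)
      where
      u₃ = u₁ + u₂ - K
      x₃≋u₃² : + x₃ ≋ u₃ * u₃
      x₃≋u₃² = ≋-trans x₃≋ (≋-sym (≋-combination₁ (- + 2) (e K u₁ u₂ A) on-line))
        where
        e : ∀ K u₁ u₂ A → (u₁ + u₂ - K) * (u₁ + u₂ - K) - (K * K - + 2 * A - u₁ * u₁ - u₂ * u₂)
                          ≡ - + 2 * (K * (u₁ + u₂) - (u₁ * u₁ + u₁ * u₂ + u₂ * u₂ + A))
        e = solve-∀
      y₃≋u₃³+Au₃ : + y₃ ≋ u₃ * (u₃ * u₃ + A)
      y₃≋u₃³+Au₃ = ≋-trans y₃≋ (≋-trans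
        (sub-cong (*-cong (≋-refl {K}) (sub-cong (≋-refl {u₁ * u₁}) x₃≋u₃²)) (≋-refl {u₁ * (u₁ * u₁ + A)}))
        (≋-combination₁ (+ 2 * u₁ + u₂ - K) (e K u₁ u₂ A) on-line))
        where
        e : ∀ K u₁ u₂ A →
          K * (u₁ * u₁ - (u₁ + u₂ - K) * (u₁ + u₂ - K)) - u₁ * (u₁ * u₁ + A)
            - (u₁ + u₂ - K) * ((u₁ + u₂ - K) * (u₁ + u₂ - K) + A)
          ≡ (+ 2 * u₁ + u₂ - K) * (K * (u₁ + u₂) - (u₁ * u₁ + u₁ * u₂ + u₂ * u₂ + A))
        e = solve-∀
      w≋ : (u₁ + u₂) * (w₁ * w₂ * (u₃ + s)) ≋ (u₁ + u₂) * (u₃ - s)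
      w≋ = ≋-combination₄ (w₂ * (u₂ + s)) (u₁ - s) (1ℤ - w₁ * w₂) (1ℤ - w₁ * w₂) (e K u₁ u₂ A s w₁ w₂)
        w₁≋ w₂≋ s²≋-a on-line
        where
        e : ∀ K u₁ u₂ A s w₁ w₂ →
          (u₁ + u₂) * (w₁ * w₂ * (u₁ + u₂ - K + s)) - (u₁ + u₂) * (u₁ + u₂ - K - s)
          ≡ w₂ * (u₂ + s) * (w₁ * (u₁ + s) - (u₁ - s)) + (u₁ - s) * (w₂ * (u₂ + s) - (u₂ - s))
            + (1ℤ - w₁ * w₂) * (s * s - - A)
            + (1ℤ - w₁ * w₂) * (K * (u₁ + u₂) - (u₁ * u₁ + u₁ * u₂ + u₂ * u₂ + A))
        e = solve-∀

    slope-chord : ℕ → ℕ → ℕ → ℕ → ℕ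
    slope-chord x₁ y₁ x₂ y₂ = (y₂ -ₚ y₁) /ₚ (x₂ -ₚ x₁)

    slope-tangent : ℕ → ℕ → ℕ
    slope-tangent x₁ y₁ = ((x₁ +ₚ a) *ₚ ((3 *ₚ x₁) +ₚ a)) /ₚ (2 *ₚ y₁)

    chord-x : ℕ → ℕ → ℕ → ℕ
    chord-x k x₁ x₂ = (((k *ₚ k) -ₚ (2 *ₚ a)) -ₚ x₁) -ₚ x₂

    tangent-x : ℕ → ℕ → ℕ
    tangent-x k x₁ = ((k *ₚ k) -ₚ (2 *ₚ a)) -ₚ (2 *ₚ x₁)

    third-y : ℕ → ℕ → ℕ → ℕ → ℕ
    third-y k x₁ x₃ y₁ = (k *ₚ (x₁ -ₚ x₃)) -ₚ y₁

    chord : ℕ → ℕ → ℕ → ℕ → Point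
    chord x₁ y₁ x₂ y₂ = just (chord-x k x₁ x₂ , third-y k x₁ (chord-x k x₁ x₂) y₁)
      where k = slope-chord x₁ y₁ x₂ y₂

    tangent : ℕ → ℕ → Point
    tangent x₁ y₁ = just (tangent-x k x₁ , third-y k x₁ (tangent-x k x₁) y₁)
      where k = slope-tangent x₁ y₁

    k²-2a-≋ : ∀ k → + ((k *ₚ k) -ₚ (2 *ₚ a)) ≋ + k * + k - + 2 * A
    k²-2a-≋ k = ≋-trans (-ₚ-≋ (k *ₚ k) (2 *ₚ a)) (sub-cong (*ₚ-≋ k k) (*ₚ-≋ 2 a))

    chord-x-≋ : ∀ k x₁ x₂ {u₁ u₂} → + x₁ ≋ u₁ * u₁ → + x₂ ≋ u₂ * u₂ →
      + chord-x k x₁ x₂ ≋ + k * + k - + 2 * A - u₁ * u₁ - u₂ * u₂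
    chord-x-≋ k x₁ x₂ x₁≋ x₂≋ = ≋-trans (-ₚ-≋ (((k *ₚ k) -ₚ (2 *ₚ a)) -ₚ x₁) x₂)
      (sub-cong (≋-trans (-ₚ-≋ ((k *ₚ k) -ₚ (2 *ₚ a)) x₁) (sub-cong (k²-2a-≋ k) x₁≋)) x₂≋)

    tangent-x-≋ : ∀ k x₁ {u₁} → + x₁ ≋ u₁ * u₁ → + tangent-x k x₁ ≋ + k * + k - + 2 * A - u₁ * u₁ - u₁ * u₁
    tangent-x-≋ k x₁ {u₁} x₁≋ = ≋-trans (-ₚ-≋ ((k *ₚ k) -ₚ (2 *ₚ a)) (2 *ₚ x₁))
      (≋-trans (sub-cong (k²-2a-≋ k) 2x₁≋) (≋-reflexive (e (+ k) A u₁)))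
      where
      2x₁≋ = ≋-trans (*ₚ-≋ 2 x₁) (*-cong (≋-refl {+ 2}) x₁≋)
      e : ∀ K A u → K * K - + 2 * A - + 2 * (u * u) ≡ K * K - + 2 * A - u * u - u * u
      e = solve-∀

    third-y-≋ : ∀ k x₁ x₃ y₁ {u₁} → + x₁ ≋ u₁ * u₁ → + y₁ ≋ u₁ * (u₁ * u₁ + A) →
      + third-y k x₁ x₃ y₁ ≋ + k * (u₁ * u₁ - + x₃) - u₁ * (u₁ * u₁ + A)
    third-y-≋ k x₁ x₃ y₁ x₁≋ y₁≋ = ≋-trans (-ₚ-≋ (k *ₚ (x₁ -ₚ x₃)) y₁)
      (sub-cong (≋-trans (*ₚ-≋ k (x₁ -ₚ x₃)) (*-cong (≋-refl {+ k}) x₁-x₃≋)) y₁≋)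
      where
      x₁-x₃≋ = ≋-trans (-ₚ-≋ x₁ x₃) (sub-cong x₁≋ (≋-refl {+ x₃}))

    slope-chord-≋ : ∀ x₁ y₁ x₂ y₂ {u₁ u₂} → + x₁ ≋ u₁ * u₁ → + y₁ ≋ u₁ * (u₁ * u₁ + A) →
      + x₂ ≋ u₂ * u₂ → + y₂ ≋ u₂ * (u₂ * u₂ + A) → (u₂ - u₁) * (u₁ + u₂) ≉0 →
      + slope-chord x₁ y₁ x₂ y₂ * (u₁ + u₂) ≋ N u₁ u₂
    slope-chord-≋ x₁ y₁ x₂ y₂ {u₁} {u₂} x₁≋ y₁≋ x₂≋ y₂≋ Δ≉0 = *-cancelˡ-≋ (≉0-*ˡ {u₂ - u₁} {u₁ + u₂} Δ≉0) (begin
      (u₂ - u₁) * (K * (u₁ + u₂))                ≡⟨ e₁ u₁ u₂ K ⟩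
      K * ((u₂ - u₁) * (u₁ + u₂))                ≈⟨ *-cong (≋-refl {K}) x₂-x₁≋Δ ⟨
      K * + (x₂ -ₚ x₁)                           ≈⟨ /ₚ-*-≋ (y₂ -ₚ y₁) (x₂ -ₚ x₁) (≋-pres-≉0 (≋-sym x₂-x₁≋Δ) Δ≉0) ⟩
      + (y₂ -ₚ y₁)                               ≈⟨ ≋-trans (-ₚ-≋ y₂ y₁) (sub-cong y₂≋ y₁≋) ⟩
      u₂ * (u₂ * u₂ + A) - u₁ * (u₁ * u₁ + A)    ≡⟨ e₂ u₁ u₂ A ⟩
      (u₂ - u₁) * N u₁ u₂                        ∎)
      where
      open SetoidReasoning ≋-setoid
      K = + slope-chord x₁ y₁ x₂ y₂
      x₂-x₁≋Δ : + (x₂ -ₚ x₁) ≋ (u₂ - u₁) * (u₁ + u₂)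
      x₂-x₁≋Δ = ≋-trans (-ₚ-≋ x₂ x₁) (≋-trans (sub-cong x₂≋ x₁≋) (≋-reflexive (e₀ u₁ u₂)))
        where
        e₀ : ∀ u₁ u₂ → u₂ * u₂ - u₁ * u₁ ≡ (u₂ - u₁) * (u₁ + u₂)
        e₀ = solve-∀
      e₁ : ∀ u₁ u₂ K → (u₂ - u₁) * (K * (u₁ + u₂)) ≡ K * ((u₂ - u₁) * (u₁ + u₂))
      e₁ = solve-∀
      e₂ : ∀ u₁ u₂ A → u₂ * (u₂ * u₂ + A) - u₁ * (u₁ * u₁ + A) ≡ (u₂ - u₁) * (u₁ * u₁ + u₁ * u₂ + u₂ * u₂ + A)
      e₂ = solve-∀

    slope-tangent-≋ : ∀ x₁ y₁ {u₁} → + x₁ ≋ u₁ * u₁ → + y₁ ≋ u₁ * (u₁ * u₁ + A) →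
      + 2 * (u₁ * (u₁ * u₁ + A)) ≉0 → + slope-tangent x₁ y₁ * (u₁ + u₁) ≋ N u₁ u₁
    slope-tangent-≋ x₁ y₁ {u₁} x₁≋ y₁≋ 2y₁≉0 = *-cancelˡ-≋ (≉0-*ʳ {u₁} (≉0-*ʳ {+ 2} 2y₁≉0)) (begin
      (u₁ * u₁ + A) * (K * (u₁ + u₁))          ≡⟨ e₁ K u₁ A ⟩
      K * (+ 2 * (u₁ * (u₁ * u₁ + A)))         ≈⟨ *-cong (≋-refl {K}) 2y₁≋ ⟨
      K * + (2 *ₚ y₁)                          ≈⟨ /ₚ-*-≋ _ (2 *ₚ y₁) (≋-pres-≉0 (≋-sym 2y₁≋) 2y₁≉0) ⟩
      + ((x₁ +ₚ a) *ₚ ((3 *ₚ x₁) +ₚ a))         ≈⟨ *ₚ-≋ (x₁ +ₚ a) ((3 *ₚ x₁) +ₚ a) ⟩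
      + (x₁ +ₚ a) * + ((3 *ₚ x₁) +ₚ a)          ≈⟨ *-cong x₁+a≋ 3x₁+a≋ ⟩
      (u₁ * u₁ + A) * (+ 3 * (u₁ * u₁) + A)    ≡⟨ e₂ u₁ A ⟩
      (u₁ * u₁ + A) * N u₁ u₁                  ∎)
      where
      open SetoidReasoning ≋-setoid
      K = + slope-tangent x₁ y₁
      2y₁≋ : + (2 *ₚ y₁) ≋ + 2 * (u₁ * (u₁ * u₁ + A))
      2y₁≋ = ≋-trans (*ₚ-≋ 2 y₁) (*-cong (≋-refl {+ 2}) y₁≋)
      x₁+a≋ : + (x₁ +ₚ a) ≋ u₁ * u₁ + A
      x₁+a≋ = ≋-trans (+ₚ-≋ x₁ a) (+-cong x₁≋ (≋-refl {A}))
      3x₁+a≋ : + ((3 *ₚ x₁) +ₚ a) ≋ + 3 * (u₁ * u₁) + A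
      3x₁+a≋ = ≋-trans (+ₚ-≋ (3 *ₚ x₁) a) (+-cong (≋-trans (*ₚ-≋ 3 x₁) (*-cong (≋-refl {+ 3}) x₁≋)) (≋-refl {A}))
      e₁ : ∀ K u A → (u * u + A) * (K * (u + u)) ≡ K * (+ 2 * (u * (u * u + A)))
      e₁ = solve-∀
      e₂ : ∀ u A → (u * u + A) * (+ 3 * (u * u) + A) ≡ (u * u + A) * (u * u + u * u + u * u + A)
      e₂ = solve-∀

    chord-↦ : ∀ {x₁ y₁ x₂ y₂ w₁ w₂} → x₁ % p ≢ x₂ % p →
      Parametrised x₁ y₁ w₁ → Parametrised x₂ y₂ w₂ → chord x₁ y₁ x₂ y₂ ↦ w₁ * w₂
    chord-↦ {x₁} {y₁} {x₂} {y₂} {w₁} {w₂} x₁≢x₂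
      (param u₁ x₁≋ y₁≋ w₁≋ w₁≉0) (param u₂ x₂≋ y₂≋ w₂≋ w₂≉0) =
      third-point (+ k) u₁ u₂ w₁ w₂ w₁≋ w₂≋ w₁≉0 w₂≉0 (≉0-*ʳ {u₂ - u₁} Δ≉0)
        (slope-chord-≋ x₁ y₁ x₂ y₂ {u₁} {u₂} x₁≋ y₁≋ x₂≋ y₂≋ Δ≉0) (m%n<n _ p)
        (chord-x-≋ k x₁ x₂ {u₁} {u₂} x₁≋ x₂≋) (third-y-≋ k x₁ (chord-x k x₁ x₂) y₁ {u₁} x₁≋ y₁≋)
      where
      k = slope-chord x₁ y₁ x₂ y₂
      Δ≉0 : (u₂ - u₁) * (u₁ + u₂) ≉0
      Δ≉0 Δ≋0 = x₁≢x₂ (≋⇒≡-mod (≋-trans x₁≋ (≋-trans (≋-combination₁ (- 1ℤ) (e u₁ u₂) Δ≋0) (≋-sym x₂≋))))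
        where
        e : ∀ u₁ u₂ → u₁ * u₁ - u₂ * u₂ ≡ - 1ℤ * ((u₂ - u₁) * (u₁ + u₂) - 0ℤ)
        e = solve-∀

    u[u²+A]-cong : ∀ {u v} → u ≋ v → u * (u * u + A) ≋ v * (v * v + A)
    u[u²+A]-cong u≋v = *-cong u≋v (+-cong (*-cong u≋v u≋v) (≋-refl {A}))

    same-x⇒u≋±u : ∀ {x₁ y₁ x₂ y₂ w₁ w₂} → x₁ % p ≡ x₂ % p →
      (P₁ : Parametrised x₁ y₁ w₁) (P₂ : Parametrised x₂ y₂ w₂) →
      Parametrised.u P₂ ≋ Parametrised.u P₁ ⊎ Parametrised.u P₂ ≋ - Parametrised.u P₁
    same-x⇒u≋±u x₁≡x₂ (param u₁ x₁≋ _ _ _) (param u₂ x₂≋ _ _ _) =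
      x²≋y²⇒x≋±y (≋-trans (≋-sym x₂≋) (≋-trans (≋-sym (≡-mod⇒≋ x₁≡x₂)) x₁≋))

    tangent-↦ : ∀ {x₁ y₁ x₂ y₂ w₁ w₂} → x₁ % p ≡ x₂ % p → y₁ +ₚ y₂ ≢ 0 →
      Parametrised x₁ y₁ w₁ → Parametrised x₂ y₂ w₂ → tangent x₁ y₁ ↦ w₁ * w₂
    tangent-↦ {x₁} {y₁} {x₂} {y₂} {w₁} {w₂} x₁≡x₂ y₁+y₂≢0
      P₁@(param u₁ x₁≋ y₁≋ w₁≋ w₁≉0) P₂@(param u₂ x₂≋ y₂≋ w₂≋ w₂≉0) =
      third-point (+ k) u₁ u₁ w₁ w₂ w₁≋ w₂≋′ w₁≉0 w₂≉0 2u₁≉0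
        (slope-tangent-≋ x₁ y₁ {u₁} x₁≋ y₁≋ 2y₁≉0) (m%n<n _ p)
        (tangent-x-≋ k x₁ {u₁} x₁≋) (third-y-≋ k x₁ (tangent-x k x₁) y₁ {u₁} x₁≋ y₁≋)
      where
      k = slope-tangent x₁ y₁
      y₁+y₂≉0 : + y₁ + + y₂ ≉0
      y₁+y₂≉0 = +ₚ≢0⇒≉0 y₁ y₂ y₁+y₂≢0
      u₂≋u₁ : u₂ ≋ u₁
      u₂≋u₁ = Sum.fromInj₁ (λ u₂≋-u₁ → contradiction (y₁+y₂≋0 u₂≋-u₁) y₁+y₂≉0) (same-x⇒u≋±u x₁≡x₂ P₁ P₂)
        where
        y₁+y₂≋0 : u₂ ≋ - u₁ → + y₁ + + y₂ ≋ 0ℤ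
        y₁+y₂≋0 u₂≋-u₁ = ≋-trans (+-cong y₁≋ (≋-trans y₂≋ (u[u²+A]-cong u₂≋-u₁))) (≋-reflexive (e u₁ A))
          where
          e : ∀ u A → u * (u * u + A) + - u * (- u * - u + A) ≡ 0ℤ
          e = solve-∀
      w₂≋′ : w₂ * (u₁ + s) ≋ u₁ - s
      w₂≋′ = ≋-trans (*-cong (≋-refl {w₂}) (+-cong (≋-sym u₂≋u₁) (≋-refl {s})))
        (≋-trans w₂≋ (sub-cong u₂≋u₁ (≋-refl {s})))
      2y₁≉0 : + 2 * (u₁ * (u₁ * u₁ + A)) ≉0
      2y₁≉0 2y₁≋0 = y₁+y₂≉0
        (≋-trans (+-cong y₁≋ (≋-trans y₂≋ (u[u²+A]-cong u₂≋u₁))) (≋-trans (≋-reflexive (e _)) 2y₁≋0))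
        where
        e : ∀ y → y + y ≡ + 2 * y
        e = solve-∀
      2u₁≉0 : u₁ + u₁ ≉0
      2u₁≉0 2u₁≋0 = ≉0-*ˡ {u₁} {u₁ * u₁ + A} (≉0-*ʳ {+ 2} 2y₁≉0)
        (*-cancelˡ-≋ 2≉0 (≋-combination₁ 1ℤ (e u₁) 2u₁≋0))
        where
        e : ∀ u → + 2 * u - + 2 * 0ℤ ≡ 1ℤ * (u + u - 0ℤ)
        e = solve-∀

    opposite-↦ : ∀ {x₁ y₁ x₂ y₂ w₁ w₂} → x₁ % p ≡ x₂ % p → y₁ +ₚ y₂ ≡ 0 →
      Parametrised x₁ y₁ w₁ → Parametrised x₂ y₂ w₂ → nothing ↦ w₁ * w₂
    opposite-↦ {x₁} {y₁} {x₂} {y₂} {w₁} {w₂} x₁≡x₂ y₁+y₂≡0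
      P₁@(param u₁ x₁≋ y₁≋ w₁≋ w₁≉0) P₂@(param u₂ x₂≋ y₂≋ w₂≋ w₂≉0) =
      *-cancelˡ-≋ (u+s≉0 P₁) (≋-combination₃ w₂ (- 1ℤ) (w₂ - 1ℤ) (e u₁ u₂ s w₁ w₂) w₁≋ w₂≋ u₁+u₂≋0)
      where
      e : ∀ u₁ u₂ s w₁ w₂ → (u₁ + s) * (w₁ * w₂) - (u₁ + s) * 1ℤ
          ≡ w₂ * (w₁ * (u₁ + s) - (u₁ - s)) + - 1ℤ * (w₂ * (u₂ + s) - (u₂ - s)) + (w₂ - 1ℤ) * (u₁ + u₂ - 0ℤ)
      e = solve-∀
      u₁+u₂≋0 : u₁ + u₂ ≋ 0ℤ
      u₁+u₂≋0 = Sum.[ u₂≋u₁⇒ , u₂≋-u₁⇒ ]′ (same-x⇒u≋±u x₁≡x₂ P₁ P₂)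
        where
        u₂≋-u₁⇒ : u₂ ≋ - u₁ → u₁ + u₂ ≋ 0ℤ
        u₂≋-u₁⇒ u₂≋-u₁ = ≋-trans (+-cong (≋-refl {u₁}) u₂≋-u₁) (≋-reflexive (ℤₚ.+-inverseʳ u₁))
        u₂≋u₁⇒ : u₂ ≋ u₁ → u₁ + u₂ ≋ 0ℤ
        u₂≋u₁⇒ u₂≋u₁ = Sum.[ u₁≋0⇒ , (λ u₁²+A≋0 → contradiction u₁²+A≋0 (u²+A≉0 P₁)) ]′
          (*≋0⇒≋0⊎≋0 (Sum.fromInj₂ (λ 2≋0 → contradiction 2≋0 2≉0) (*≋0⇒≋0⊎≋0 2Y₁≋0)))
          where
          u₁≋0⇒ : u₁ ≋ 0ℤ → u₁ + u₂ ≋ 0ℤ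
          u₁≋0⇒ u₁≋0 = +-cong u₁≋0 (≋-trans u₂≋u₁ u₁≋0)
          2Y₁≋0 : + 2 * (u₁ * (u₁ * u₁ + A)) ≋ 0ℤ
          2Y₁≋0 = ≋-trans (≋-reflexive (e′ (u₁ * (u₁ * u₁ + A))))
            (≋-trans (+-cong (≋-sym y₁≋) (≋-trans (u[u²+A]-cong (≋-sym u₂≋u₁)) (≋-sym y₂≋)))
              (+ₚ≡0⇒≋0 y₁ y₂ y₁+y₂≡0))
            where
            e′ : ∀ y → + 2 * y ≡ y + y
            e′ = solve-∀

    add-↦ : ∀ R₁ R₂ {w₁ w₂} → R₁ ↦ w₁ → R₂ ↦ w₂ → add a R₁ R₂ ↦ w₁ * w₂
    add-↦ nothing R₂ {w₁} {w₂} w₁≋1 R₂↦w₂ =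
      ↦-resp-≋ R₂ (≋-sym (≋1⇒*-identityˡ w₂ w₁≋1)) R₂↦w₂
    add-↦ R₁@(just _) nothing {w₁} {w₂} R₁↦w₁ w₂≋1 =
      ↦-resp-≋ R₁ (≋-sym (≋1⇒*-identityʳ w₁ w₂≋1)) R₁↦w₁
    add-↦ (just (x₁ , y₁)) (just (x₂ , y₂)) (_ , P₁) (_ , P₂) with x₁ % p ℕₚ.≟ x₂ % p
    ... | no x₁≢x₂ = chord-↦ x₁≢x₂ P₁ P₂
    ... | yes x₁≡x₂ with (y₁ +ₚ y₂) ℕₚ.≟ 0
    ...   | yes y₁+y₂≡0 = opposite-↦ x₁≡x₂ y₁+y₂≡0 P₁ P₂
    ...   | no  y₁+y₂≢0 = tangent-↦ x₁≡x₂ y₁+y₂≢0 P₁ P₂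

    smul-↦ : ∀ n R {w} → R ↦ w → smul a n R ↦ w ^ n
    smul-↦ zero    R R↦w = ≋-refl
    smul-↦ (suc n) R R↦w = add-↦ R (smul a n R) R↦w (smul-↦ n R R↦w)

    ↦1⇒∞ : ∀ R {w} → R ↦ w → w ≋ 1ℤ → R ≡ nothing
    ↦1⇒∞ nothing      _                              _    = refl
    ↦1⇒∞ (just _) {w} (_ , param u _ _ w[u+s]≋u-s _) w≋1 = contradiction 2s≋0 (*-≉0 2≉0 s≉0)
      where
      2s≋0 : + 2 * s ≋ 0ℤ
      2s≋0 = ≋-combination₁ 1ℤ (e u s)
        (≋-trans (≋-sym (≋1⇒*-identityˡ (u + s) w≋1)) w[u+s]≋u-s)
        where
        e : ∀ u s → + 2 * s - 0ℤ ≡ 1ℤ * (u + s - (u - s))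
        e = solve-∀

    ↦√-1⇒order4 : ∀ Q {W} → Q ↦ W → W * W ≋ - 1ℤ → HasOrder4 a Q
    ↦√-1⇒order4 Q {W} Q↦W W²≋-1 = ↦1⇒∞ (smul a 4 Q) (smul-↦ 4 Q Q↦W) W⁴≋1 , 2Q≢∞
      where
      W²≋W*W : W ^ 2 ≋ W * W
      W²≋W*W = ≋-reflexive (cong (W *_) (ℤₚ.*-identityʳ W))
      W⁴≋1 : W ^ 4 ≋ 1ℤ
      W⁴≋1 = ≋-trans (≋-reflexive (e W)) (≋-trans (*-cong W²≋-1 W²≋-1) ≋-refl)
        where
        e : ∀ W → W * (W * (W * (W * 1ℤ))) ≡ W * W * (W * W)
        e = solve-∀
      2Q≢∞ : smul a 2 Q ≢ nothing
      2Q≢∞ 2Q≡∞ = 1≉-1 (≋-trans (≋-sym (subst (_↦ W ^ 2) 2Q≡∞ (smul-↦ 2 Q Q↦W))) (≋-trans W²≋W*W W²≋-1))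

    ↦√-1⇒coordinates : ∀ {z w W} → a ℕ.< p → z ℕ.< p → Parametrised z w W → W * W ≋ - 1ℤ →
      z ≡ a × (w /ₚ (2 ℕ.* a)) *ₚ (w /ₚ (2 ℕ.* a)) ≡ a
    ↦√-1⇒coordinates {z} {w} {W} a<p z<p (param u z≋u² w≋ W≋ W≉0) W²≋-1 =
      ≋⇒≡ z<p a<p (≋-trans z≋u² u²≋A) ,
      ≋⇒≡ (m%n<n _ p) a<p (≋-trans (*ₚ-≋ r r) (≋-trans (*-cong r≋u r≋u) u²≋A))
      where
      u²≋A : u * u ≋ A
      u²≋A = *-cancelˡ-≋ (*-≉0 2≉0 W≉0)
        (≋-combination₃ (u * u - s * s) (- (u * (W - 1ℤ) - s * (W + 1ℤ))) (- (+ 2 * W)) (e u s W A)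
          W²≋-1 W≋ s²≋-a)
        where
        e : ∀ u s W A → + 2 * W * (u * u) - + 2 * W * A
          ≡ (u * u - s * s) * (W * W - - 1ℤ) + - (u * (W - 1ℤ) - s * (W + 1ℤ)) * (W * (u + s) - (u - s))
            + - (+ 2 * W) * (s * s - - A)
        e = solve-∀
      2a = + (2 ℕ.* a)
      2a≉0 : 2a ≉0
      2a≉0 2a≋0 = *-≉0 2≉0 a≉0 (≋-trans (≋-reflexive (sym (ℤₚ.pos-* 2 a))) 2a≋0)
      r = w /ₚ (2 ℕ.* a)
      r≋u : + r ≋ u
      r≋u = *-cancelˡ-≋ 2a≉0 (begin
        2a * + r              ≡⟨ ℤₚ.*-comm 2a (+ r) ⟩
        + r * 2a              ≈⟨ /ₚ-*-≋ w (2 ℕ.* a) 2a≉0 ⟩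
        + w                   ≈⟨ w≋ ⟩
        u * (u * u + A)       ≈⟨ *-cong (≋-refl {u}) (+-cong u²≋A (≋-refl {A})) ⟩
        u * (A + A)           ≡⟨ e u A ⟩
        + 2 * A * u           ≡⟨ cong (_* u) (ℤₚ.pos-* 2 a) ⟨
        2a * u                ∎)
        where
        open SetoidReasoning ≋-setoid
        e : ∀ u A → u * (A + A) ≡ + 2 * A * u
        e = solve-∀

    point : ℕ → Point
    point t = just ((t ℕ.* t) % p , (t ℕ.* (t ℕ.* t ℕ.+ a)) % p)

    image : ℕ → ℤ
    image t = (+ t - s) * (+ t + s) ^ (p ℕ.∸ 2)

    [t-s][t+s]≉0 : ∀ t → + t * + t + A ≉0 → (+ t - s) * (+ t + s) ≉0
    [t-s][t+s]≉0 t t²+A≉0 d≋0 = t²+A≉0 (≋-trans (u²+A≋[u-s][u+s] (+ t)) d≋0)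

    image-*-≋ : ∀ t → + t * + t + A ≉0 → image t * (+ t + s) ≋ + t - s
    image-*-≋ t t²+A≉0 = begin
      (+ t - s) * (+ t + s) ^ (p ℕ.∸ 2) * (+ t + s)   ≡⟨ e (+ t - s) ((+ t + s) ^ (p ℕ.∸ 2)) (+ t + s) ⟩
      (+ t - s) * ((+ t + s) * (+ t + s) ^ (p ℕ.∸ 2)) ≈⟨ *-cong (≋-refl {+ t - s}) (*-inverse t+s≉0) ⟩
      (+ t - s) * 1ℤ                                  ≡⟨ ℤₚ.*-identityʳ (+ t - s) ⟩
      + t - s                                         ∎
      where
      open SetoidReasoning ≋-setoid
      t+s≉0 = ≉0-*ʳ {+ t - s} ([t-s][t+s]≉0 t t²+A≉0)
      e : ∀ x i y → x * i * y ≡ x * (y * i)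
      e = solve-∀

    image≉0 : ∀ t → + t * + t + A ≉0 → image t ≉0
    image≉0 t t²+A≉0 image≋0 = ≉0-*ˡ {+ t - s} {+ t + s} ([t-s][t+s]≉0 t t²+A≉0)
      (≋-trans (≋-sym (image-*-≋ t t²+A≉0)) (*-≋0ˡ (+ t + s) image≋0))

    point-↦ : ∀ t → + t * + t + A ≉0 → point t ↦ image t
    point-↦ t t²+A≉0 = m%n<n _ p , param (+ t) x≋t² y≋ (image-*-≋ t t²+A≉0) (image≉0 t t²+A≉0)
      where
      x≋t² : + ((t ℕ.* t) % p) ≋ + t * + t
      x≋t² = ≋-trans (%-≋ (t ℕ.* t)) (≋-reflexive (ℤₚ.pos-* t t))
      y≋ : + ((t ℕ.* (t ℕ.* t ℕ.+ a)) % p) ≋ + t * (+ t * + t + A)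
      y≋ = ≋-trans (%-≋ _) (≋-reflexive (trans (ℤₚ.pos-* t (t ℕ.* t ℕ.+ a))
        (cong (+ t *_) (trans (ℤₚ.pos-+ (t ℕ.* t) a) (cong (_+ A) (ℤₚ.pos-* t t))))))

    image-nonsquare : ∀ t → (∀ C → ¬ (C * C ≋ + t * + t + A)) → ∀ C → ¬ (C * C ≋ image t)
    image-nonsquare t t²+A-nonsquare C C²≋image = t²+A-nonsquare (C * (+ t + s)) (begin
      C * (+ t + s) * (C * (+ t + s))   ≡⟨ e C (+ t + s) ⟩
      C * C * (+ t + s) * (+ t + s)     ≈⟨ *-cong (*-cong C²≋image (≋-refl {+ t + s})) (≋-refl {+ t + s}) ⟩
      image t * (+ t + s) * (+ t + s)   ≈⟨ *-cong (image-*-≋ t t²+A≉0) (≋-refl {+ t + s}) ⟩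
      (+ t - s) * (+ t + s)             ≈⟨ u²+A≋[u-s][u+s] (+ t) ⟨
      + t * + t + A                     ∎)
      where
      open SetoidReasoning ≋-setoid
      t²+A≉0 : + t * + t + A ≉0
      t²+A≉0 t²+A≋0 = t²+A-nonsquare 0ℤ (≋-sym t²+A≋0)
      e : ∀ C T → C * T * (C * T) ≡ C * C * T * T
      e = solve-∀

  order4-multiple : ∀ n → q ≡ 2 ℕ.* n → ∀ {a} → a ℕ.< p → a ≢ 0 → IsSquare a →
    ∀ t → ¬ IsSquare (t ℕ.* t ℕ.+ a) →
    HasOrder4 a (smul a n (just ((t ℕ.* t) % p , (t ℕ.* (t ℕ.* t ℕ.+ a)) % p))) ×
    (∀ z w → smul a n (just ((t ℕ.* t) % p , (t ℕ.* (t ℕ.* t ℕ.+ a)) % p)) ≡ just (z , w) →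
      z ≡ a × (w /ₚ (2 ℕ.* a)) *ₚ (w /ₚ (2 ℕ.* a)) ≡ a)
  order4-multiple n q≡2n {a} a<p a≢0 a-square t t²+a-nonsquare = ↦√-1⇒order4 Q Q↦W W²≋-1 , coordinates
    where
    a≉0 : + a ≉0
    a≉0 a≋0 = a≢0 (≋⇒≡ a<p (ℕ.>-nonZero⁻¹ p) a≋0)
    s = proj₁ (√-a n q≡2n a-square)
    open SplitNode a s (proj₂ (√-a n q≡2n a-square)) a≉0
    t²+A-nonsquare : ∀ C → ¬ (C * C ≋ + t * + t + A)
    t²+A-nonsquare C C²≋ = ¬IsSquare⇒∄≋ t²+a-nonsquare C
      (≋-trans C²≋ (≋-reflexive (sym (trans (ℤₚ.pos-+ (t ℕ.* t) a) (cong (_+ A) (ℤₚ.pos-* t t))))))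
    t²+A≉0 : + t * + t + A ≉0
    t²+A≉0 t²+A≋0 = t²+A-nonsquare 0ℤ (≋-sym t²+A≋0)
    W = image t ^ n
    W²≋-1 : W * W ≋ - 1ℤ
    W²≋-1 = begin
      image t ^ n * image t ^ n   ≡⟨ ℤₚ.^-distribˡ-+-* (image t) n n ⟨
      image t ^ (n ℕ.+ n)         ≡⟨ cong (image t ^_) n+n≡q ⟩
      image t ^ q                 ≈⟨ euler (image≉0 t t²+A≉0) (image-nonsquare t t²+A-nonsquare) ⟩
      - 1ℤ                        ∎
      where
      open SetoidReasoning ≋-setoid
      n+n≡q : n ℕ.+ n ≡ q
      n+n≡q = trans (cong (n ℕ.+_) (sym (ℕₚ.+-identityʳ n))) (sym q≡2n)
    Q = smul a n (point t)
    Q↦W : Q ↦ W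
    Q↦W = smul-↦ n (point t) (point-↦ t t²+A≉0)
    coordinates : ∀ z w → Q ≡ just (z , w) → z ≡ a × (w /ₚ (2 ℕ.* a)) *ₚ (w /ₚ (2 ℕ.* a)) ≡ a
    coordinates z w Q≡zw = ↦√-1⇒coordinates a<p (proj₁ zw↦W) (proj₂ zw↦W) W²≋-1
      where
      zw↦W : just (z , w) ↦ W
      zw↦W = subst (_↦ W) Q≡zw Q↦W

open import Data.Nat using (_+_; _*_; _∸_; _^_; _<_)

odd⇒2∤ : ∀ {m} → m % 2 ≡ 1 → ¬ (2 ∣ m)
odd⇒2∤ {m} m-odd 2∣m = ℕₚ.1+n≢0 (trans (sym m-odd) (n∣m⇒m%n≡0 m 2 2∣m))

4∣2^e*m⇒e≡2+i : ∀ e {m} → 4 ∣ 2 ^ e * m → m % 2 ≡ 1 → ∃[ i ] e ≡ 2 + i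
4∣2^e*m⇒e≡2+i zero          {m} 4∣m  m-odd =
  contradiction (∣-trans (divides 2 refl) (subst (4 ∣_) (ℕₚ.*-identityˡ m) 4∣m)) (odd⇒2∤ m-odd)
4∣2^e*m⇒e≡2+i (suc zero)    {m} 4∣2m m-odd = contradiction (*-cancelˡ-∣ {m = 2} {n = m} 2 4∣2m) (odd⇒2∤ m-odd)
4∣2^e*m⇒e≡2+i (suc (suc i)) _    _     = i , refl

%8≡1⇒4∣∸1 : ∀ n → n % 8 ≡ 1 → 4 ∣ n ∸ 1
%8≡1⇒4∣∸1 n n%8≡1 = ∣-trans (divides 2 refl) (divides (n / 8) (cong (_∸ 1) n≡1+[n/8]*8))
  where
  n≡1+[n/8]*8 : n ≡ 1 + n / 8 * 8
  n≡1+[n/8]*8 = trans (m≡m%n+[m/n]*n n 8) (cong (_+ n / 8 * 8) n%8≡1)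

mainTheorem4 : (p : ℕ) → .{{_ : NonZero p}} → Prime p → p % 8 ≡ 1 →
    (e m : ℕ) → p ∸ 1 ≡ 2 ^ e * m → m % 2 ≡ 1 →
    (a : ℕ) → a < p → a ≢ 0 → Fp.IsSquare p a →
    (t : ℕ) → t < p → t ≢ 0 → ¬ Fp.IsSquare p (t * t + a) →
    ∃[ i ] (i < e
      × Fp.HasOrder4 p a (Fp.smul p a (2 ^ i * m) (just ((t * t) % p , (t * (t * t + a)) % p)))
      × ((z w : ℕ) → Fp.smul p a (2 ^ i * m) (just ((t * t) % p , (t * (t * t + a)) % p)) ≡ just (z , w) →
          (z ≡ a) × (Fp._*ₚ_ p (Fp._/ₚ_ p w (2 * a)) (Fp._/ₚ_ p w (2 * a)) ≡ a)))
mainTheorem4 p p-prime p%8≡1 e m p∸1≡2ᵉm m-odd a a<p a≢0 a-square t _ _ t²+a-nonsquare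
  with 4∣2^e*m⇒e≡2+i e (subst (4 ∣_) p∸1≡2ᵉm (%8≡1⇒4∣∸1 p p%8≡1)) m-odd
... | i , refl = i , ℕₚ.m<n+m i ℕ.z<s ,
  OddPrime.order4-multiple p p-prime (2 * (2 ^ i * m)) p≡1+2q (2 ^ i * m) refl a<p a≢0 a-square t t²+a-nonsquare
  where
  p≡1+2q : p ≡ suc (2 * (2 * (2 ^ i * m)))
  p≡1+2q = trans (sym (ℕₚ.suc-pred p)) (cong suc (trans p∸1≡2ᵉm (assoc (2 ^ i) m)))
    where
    assoc : ∀ x m → 2 * (2 * x) * m ≡ 2 * (2 * (x * m))
    assoc = ℕ-Solver.solve-∀
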